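{- Let $G$ be a graph with connected components $G_1,\ldots,G_k$. Then \[ h^{\ast}(\mathcal{C}_{G};z)=\prod_{i=1}^k h^\ast(\mathcal{C}_{G_i};z). \]
   Context: A graph $G=(V,E)$ is a finite undirected graph with vertex set $V$ and a finite multiset $E$ of edges; multiple edges and loops are allowed, and $G$ has no isolated vertices. Let $\mathbb{R}^{V\cup E}$ have standard unit vectors $\mathbf{e}_\alpha$, $\alpha\in V\cup E$. The cosmological polytope of $G$ is $\mathcal{C}_G=\mathrm{conv}(\mathbf{e}_i+\mathbf{e}_j-\mathbf{e}_f,\ \mathbf{e}_i-\mathbf{e}_j+\mathbf{e}_f,\ -\mathbf{e}_i+\mathbf{e}_j+\mathbf{e}_f : f\in E \text{ with endpoints } i,j)\subset\mathbb{R}^{V\cup E}$ (for a loop, $i=j$); it is a lattice polytope of dimension $|V|+|E|-1$. For a $d$-dimensional lattice polytope $P\subset\mathbb{R}^N$, the $h^\ast$-polynomial $h^\ast(P;z)$ is the polynomial defined by $1+\sum_{t\ge1}|tP\cap\mathbb{Z}^N|z^t=h^\ast(P;z)/(1-z)^{d+1}$. -}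

module Defs where

open import Data.Nat as ℕ using (ℕ; zero; suc; _∸_)
open import Data.Nat.Combinatorics using (_C_)
open import Data.Integer as ℤ using (ℤ; +_; -[1+_])
open import Data.Rational as ℚ using (ℚ; 0ℚ; _/_)
open import Data.Fin as Fin using (Fin; _↑ˡ_; _↑ʳ_; splitAt)
open import Data.Fin.Properties using () renaming (_≟_ to _≟F_)
open import Data.Vec as Vec using (Vec; tabulate; zipWith)
open import Data.List as List using (List; []; _∷_; length; _++_; foldr)
open import Data.List.Membership.Propositional using (_∈_)
open import Data.List.Relation.Unary.Unique.Propositional using (Unique)
open import Data.Product using (Σ; _×_; _,_; proj₁; proj₂; ∃)
open import Data.Sum using (_⊎_; inj₁; inj₂)
open import Data.Bool using (if_then_else_)
open import Relation.Nullary.Decidable using (⌊_⌋)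
open import Relation.Binary.PropositionalEquality using (_≡_)
open import Function.Bundles using (_↔_; Inverse)

-- Graphs: vertices Fin nV, edges Fin nE (a multiset of edges, each with
-- an unordered pair of endpoints recorded as an ordered pair; loops i = j
-- allowed).

record Graph : Set where
  constructor graph
  field
    nV   : ℕ
    nE   : ℕ
    ends : Fin nE → Fin nV × Fin nV
open Graph public

Joins : (G : Graph) → Fin (nE G) → Fin (nV G) → Fin (nV G) → Set
Joins G f u v = (ends G f ≡ (u , v)) ⊎ (ends G f ≡ (v , u))

NoIsolated : Graph → Set
NoIsolated G = (v : Fin (nV G)) → Σ (Fin (nE G)) λ f →
  (proj₁ (ends G f) ≡ v) ⊎ (proj₂ (ends G f) ≡ v)

data Walk (G : Graph) : Fin (nV G) → Fin (nV G) → Set where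
  here : ∀ {u} → Walk G u u
  step : ∀ {u w v} (f : Fin (nE G)) → Joins G f u w → Walk G w v → Walk G u v

Connected : Graph → Set
Connected G = Fin (nV G) × ((u v : Fin (nV G)) → Walk G u v)

_⊕_ : Graph → Graph → Graph
G ⊕ H = graph (nV G ℕ.+ nV H) (nE G ℕ.+ nE H) e
  where
  e : Fin (nE G ℕ.+ nE H) → Fin (nV G ℕ.+ nV H) × Fin (nV G ℕ.+ nV H)
  e f with splitAt (nE G) f
  ... | inj₁ g = (proj₁ (ends G g) ↑ˡ nV H) , (proj₂ (ends G g) ↑ˡ nV H)
  ... | inj₂ h = (nV G ↑ʳ proj₁ (ends H h)) , (nV G ↑ʳ proj₂ (ends H h))

emptyGraph : Graph
emptyGraph = graph 0 0 (λ ())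

⨆ : List Graph → Graph
⨆ = foldr _⊕_ emptyGraph

record _≅_ (G H : Graph) : Set where
  field
    φV : Fin (nV G) ↔ Fin (nV H)
    φE : Fin (nE G) ↔ Fin (nE H)
    preserves : (f : Fin (nE G)) →
      Joins H (Inverse.to φE f)
        (Inverse.to φV (proj₁ (ends G f))) (Inverse.to φV (proj₂ (ends G f)))

Pt : ℕ → Set
Pt N = Vec ℤ N

unit : ∀ {N} → Fin N → Pt N
unit α = tabulate λ β → if ⌊ α ≟F β ⌋ then + 1 else + 0

_+ᵥ_ _-ᵥ_ : ∀ {N} → Pt N → Pt N → Pt N
_+ᵥ_ = zipWith ℤ._+_
_-ᵥ_ = zipWith ℤ._-_

-- coordinates of ℝ^{V ∪ E}: vertex i ↦ i ↑ˡ nE, edge f ↦ nV ↑ʳ f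
dimG : Graph → ℕ
dimG G = nV G ℕ.+ nE G

cosmoGens : (G : Graph) → List (Pt (dimG G))
cosmoGens G = List.concatMap gens (List.allFin (nE G))
  where
  gens : Fin (nE G) → List (Pt (dimG G))
  gens f =
    let i  = unit (proj₁ (ends G f) ↑ˡ nE G)
        j  = unit (proj₂ (ends G f) ↑ˡ nE G)
        ef = unit (nV G ↑ʳ f)
    in ((i +ᵥ j) -ᵥ ef) ∷ ((i -ᵥ j) +ᵥ ef) ∷ ((j -ᵥ i) +ᵥ ef) ∷ []

sumFin : ∀ {m} → (Fin m → ℚ) → ℚ
sumFin {zero}  f = 0ℚ
sumFin {suc m} f = f Fin.zero ℚ.+ sumFin (λ i → f (Fin.suc i))

toℚ : ℤ → ℚ
toℚ z = z / 1

InDilate : ∀ {N} → List (Pt N) → ℕ → Pt N → Set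
InDilate {N} pts t x =
  Σ (Fin (length pts) → ℚ) λ lam →
    ((p : Fin (length pts)) → 0ℚ ℚ.≤ lam p) ×
    (sumFin lam ≡ toℚ (+ t)) ×
    ((α : Fin N) →
      sumFin (λ p → lam p ℚ.* toℚ (Vec.lookup (List.lookup pts p) α))
        ≡ toℚ (Vec.lookup x α))

LatticeCount : ∀ {N} → List (Pt N) → ℕ → ℕ → Set
LatticeCount {N} pts t c =
  Σ (List (Pt N)) λ xs →
    (length xs ≡ c) × Unique xs ×
    ((x : Pt N) → (x ∈ xs → InDilate pts t x) × (InDilate pts t x → x ∈ xs))

-- polynomials as coefficient lists
coeff : List ℤ → ℕ → ℤ
coeff []       _       = + 0
coeff (a ∷ p)  zero    = a
coeff (a ∷ p)  (suc m) = coeff p m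

_+P_ : List ℤ → List ℤ → List ℤ
[]      +P q       = q
(a ∷ p) +P []      = a ∷ p
(a ∷ p) +P (b ∷ q) = (a ℤ.+ b) ∷ (p +P q)

_*P_ : List ℤ → List ℤ → List ℤ
[]      *P q = []
(a ∷ p) *P q = List.map (a ℤ.*_) q +P (+ 0 ∷ (p *P q))

polyProd : List (List ℤ) → List ℤ
polyProd = foldr _*P_ (+ 1 ∷ [])

sumUpTo : ℕ → (ℕ → ℤ) → ℤ
sumUpTo zero    f = f 0
sumUpTo (suc m) f = sumUpTo m f ℤ.+ f (suc m)

sign : ℕ → ℤ
sign zero    = + 1
sign (suc j) = ℤ.- sign j

-- h is the h*-polynomial of P = conv(pts) ⊂ ℝ^N with dim P = D - 1:
--   1 + Σ_{t≥1} |tP ∩ ℤ^N| z^t = h(z) / (1-z)^D,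
-- i.e. h(z) = (1-z)^D · (1 + Σ_{t≥1} L(t) z^t), compared coefficientwise.
IsHStar : ∀ {N} → List (Pt N) → (D : ℕ) → List ℤ → Set
IsHStar pts D h =
  Σ (ℕ → ℕ) λ L →
    ((t : ℕ) → LatticeCount pts (suc t) (L (suc t))) ×
    ((m : ℕ) → coeff h m ≡
       sumUpTo m (λ j → sign j ℤ.* (+ (D C j)) ℤ.* (+ L′ L (m ∸ j))))
  where
  L′ : (ℕ → ℕ) → ℕ → ℕ
  L′ L zero    = 1
  L′ L (suc t) = L (suc t)

-- h is the h*-polynomial of the cosmological polytope C_G,
-- which has dimension |V| + |E| - 1
IsHStarCosmo : Graph → List ℤ → Set
IsHStarCosmo G h = IsHStar (cosmoGens G) (dimG G) h

{-# OPTIONS --safe #-}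
module Submission where

-- The generators of C_G all have coordinate sum 1, and those of a disjoint union G ⊕ H are
-- the generators of G and of H placed in complementary blocks of coordinates: C_{G ⊕ H} is
-- the free join of C_G and C_H. Splitting a conic combination along the two blocks and
-- reading the two weights off the coordinate sums shows that the lattice points of
-- t · C_{G ⊕ H} are exactly the pairs of lattice points of a · C_G and b · C_H with
-- a + b = t. Hence the Ehrhart series multiply, and since
-- dim C_{G ⊕ H} + 1 = (dim C_G + 1) + (dim C_H + 1), so do the h*-polynomials. An
-- isomorphism G ≅ ⨆ Gs permutes coordinates and generators, which preserves all counts.

open import Defs
open import Algebra.Bundles using (CommutativeMonoid; CommutativeSemigroup)
import Algebra.Properties.CommutativeSemigroup as CommutativeSemigroupProperties
open import Algebra.Structures using (IsCommutativeSemigroup)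
open import Data.Bool using (if_then_else_)
open import Data.Empty using (⊥-elim)
open import Data.Fin as Fin using (Fin; _↑ˡ_; _↑ʳ_)
open import Data.Fin.Permutation using (↔⇒≡)
open import Data.Fin.Properties using (splitAt-↑ˡ; splitAt-↑ʳ; +↔⊎) renaming (_≟_ to _≟F_)
open import Data.Integer as ℤ using (ℤ; +_; -[1+_]; 0ℤ; 1ℤ; _+_; _*_; -_; _-_)
import Data.Integer.Properties as ℤP
open import Data.Integer.Tactic.RingSolver using (solve-∀)
open import Data.List as List
  using (List; []; _∷_; _++_; length; concatMap; allFin; cartesianProductWith)
import Data.List.Properties as ListP
open import Data.List.Membership.Propositional using (_∈_; lose)
open import Data.List.Membership.Propositional.Properties
  using ( ∈-++⁺ˡ; ∈-++⁺ʳ; ∈-++⁻; ∈-map⁺; ∈-map⁻; ∈-allFin; ∈-concatMap⁺; ∈-concatMap⁻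
        ; ∈-cartesianProductWith⁺; ∈-cartesianProductWith⁻)
open import Data.List.Relation.Binary.Pointwise using (Pointwise; []; _∷_)
open import Data.List.Relation.Binary.Subset.Propositional using (_⊆_)
import Data.List.Relation.Binary.Subset.Propositional.Properties as Subset
open import Data.List.Relation.Unary.All using (All; [])
import Data.List.Relation.Unary.AllPairs as AllPairs
open import Data.List.Relation.Unary.Any using (here; there; satisfied)
open import Data.List.Relation.Unary.Unique.Propositional using (Unique)
import Data.List.Relation.Unary.Unique.Propositional.Properties as Unique
open import Data.Maybe using (Maybe; just; nothing; maybe; _>>=_)
open import Data.Maybe.Properties using (just-injective)
open import Data.Nat as ℕ using (ℕ; zero; suc; _∸_)
open import Data.Nat.Combinatorics using (_C_; nCk+nC[k+1]≡[n+1]C[k+1])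
import Data.Nat.Coprimality as Coprimality
import Data.Nat.Properties as ℕP
open import Data.Nat.Tactic.RingSolver using () renaming (solve-∀ to ℕ-solve-∀)
open import Data.Product using (Σ; ∃; ∃₂; _×_; _,_; proj₁; proj₂)
open import Data.Rational as ℚ using (ℚ; 0ℚ; mkℚ)
import Data.Rational.Properties as ℚP
open import Data.Sum using (_⊎_; inj₁; inj₂; [_,_]; isInj₁; isInj₂)
open import Data.Sum.Algebra using (⊎-cong)
open import Data.Vec as Vec using (lookup; tabulate; zipWith)
import Data.Vec.Functional as VecF
import Data.Vec.Properties as VecP
open import Data.Vec.Relation.Binary.Pointwise.Extensional using (ext; Pointwise-≡⇒≡)
open import Function.Base using (_∘_; const)
open import Function.Bundles using (_↔_; _⇔_; Inverse; Equivalence; mk⇔; mk↔ₛ′)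
open import Function.Properties.Inverse using (↔-sym; ↔-trans)
open import Level using (0ℓ)
open import Relation.Binary.Bundles using (Setoid)
open import Relation.Binary.PropositionalEquality hiding ([_])
import Relation.Binary.Reasoning.Setoid as SetoidReasoning
open import Relation.Nullary using (yes; no; ¬_; contradiction)
open import Relation.Nullary.Decidable using (⌊_⌋)

-- Formal power series

Series : Set
Series = ℕ → ℤ

0ₛ 1ₛ : Series
0ₛ _       = 0ℤ
1ₛ zero    = 1ℤ
1ₛ (suc _) = 0ℤ

infixl 6 _+ₛ_
_+ₛ_ : Series → Series → Series
(f +ₛ g) m = f m + g m

infixr 8 _·ₛ_
_·ₛ_ : ℤ → Series → Series
(c ·ₛ f) m = c * f m

infixl 7 _⋆_
_⋆_ : Series → Series → Series
(f ⋆ g) zero    = f 0 * g 0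
(f ⋆ g) (suc m) = f 0 * g (suc m) + (f ∘ suc ⋆ g) m

⋆-cong : ∀ {f f′ g g′} → f ≗ f′ → g ≗ g′ → f ⋆ g ≗ f′ ⋆ g′
⋆-cong f≗f′ g≗g′ zero    = cong₂ _*_ (f≗f′ 0) (g≗g′ 0)
⋆-cong f≗f′ g≗g′ (suc m) =
  cong₂ _+_ (cong₂ _*_ (f≗f′ 0) (g≗g′ (suc m))) (⋆-cong (f≗f′ ∘ suc) g≗g′ m)

⋆-zeroˡ : ∀ g → 0ₛ ⋆ g ≗ 0ₛ
⋆-zeroˡ g zero    = ℤP.*-zeroˡ (g 0)
⋆-zeroˡ g (suc m) = cong₂ _+_ (ℤP.*-zeroˡ (g (suc m))) (⋆-zeroˡ g m)

⋆-identityˡ : ∀ g → 1ₛ ⋆ g ≗ g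
⋆-identityˡ g zero    = ℤP.*-identityˡ (g 0)
⋆-identityˡ g (suc m) = begin
  1ℤ * g (suc m) + (0ₛ ⋆ g) m ≡⟨ cong₂ _+_ (ℤP.*-identityˡ (g (suc m))) (⋆-zeroˡ g m) ⟩
  g (suc m) + 0ℤ              ≡⟨ ℤP.+-identityʳ (g (suc m)) ⟩
  g (suc m)                   ∎
  where open ≡-Reasoning

⋆-distribʳ-+ₛ : ∀ f g h → (f +ₛ g) ⋆ h ≗ f ⋆ h +ₛ g ⋆ h
⋆-distribʳ-+ₛ f g h zero    = ℤP.*-distribʳ-+ (h 0) (f 0) (g 0)
⋆-distribʳ-+ₛ f g h (suc m) = begin
  (f 0 + g 0) * h (suc m) + ((f ∘ suc +ₛ g ∘ suc) ⋆ h) m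
    ≡⟨ cong (λ y → (f 0 + g 0) * h (suc m) + y) (⋆-distribʳ-+ₛ (f ∘ suc) (g ∘ suc) h m) ⟩
  (f 0 + g 0) * h (suc m) + ((f ∘ suc ⋆ h) m + (g ∘ suc ⋆ h) m)
    ≡⟨ regroup (f 0) (g 0) (h (suc m)) _ _ ⟩
  (f 0 * h (suc m) + (f ∘ suc ⋆ h) m) + (g 0 * h (suc m) + (g ∘ suc ⋆ h) m) ∎
  where
  open ≡-Reasoning
  regroup : ∀ a b c x y → (a + b) * c + (x + y) ≡ (a * c + x) + (b * c + y)
  regroup = solve-∀

·ₛ-⋆-assoc : ∀ c f h → (c ·ₛ f) ⋆ h ≗ c ·ₛ (f ⋆ h)
·ₛ-⋆-assoc c f h zero    = ℤP.*-assoc c (f 0) (h 0)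
·ₛ-⋆-assoc c f h (suc m) = begin
  c * f 0 * h (suc m) + ((c ·ₛ (f ∘ suc)) ⋆ h) m
    ≡⟨ cong₂ _+_ (ℤP.*-assoc c (f 0) (h (suc m))) (·ₛ-⋆-assoc c (f ∘ suc) h m) ⟩
  c * (f 0 * h (suc m)) + c * (f ∘ suc ⋆ h) m
    ≡⟨ ℤP.*-distribˡ-+ c _ _ ⟨
  c * (f 0 * h (suc m) + (f ∘ suc ⋆ h) m) ∎
  where open ≡-Reasoning

⋆-assoc : ∀ f g h → (f ⋆ g) ⋆ h ≗ f ⋆ (g ⋆ h)
⋆-assoc f g h zero    = ℤP.*-assoc (f 0) (g 0) (h 0)
⋆-assoc f g h (suc m) = begin
  f 0 * g 0 * h (suc m) + ((f 0 ·ₛ (g ∘ suc) +ₛ f ∘ suc ⋆ g) ⋆ h) m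
    ≡⟨ cong (λ y → f 0 * g 0 * h (suc m) + y) (⋆-distribʳ-+ₛ (f 0 ·ₛ (g ∘ suc)) (f ∘ suc ⋆ g) h m) ⟩
  f 0 * g 0 * h (suc m) + (((f 0 ·ₛ (g ∘ suc)) ⋆ h) m + (f ∘ suc ⋆ g ⋆ h) m)
    ≡⟨ cong₂ (λ x y → f 0 * g 0 * h (suc m) + (x + y))
             (·ₛ-⋆-assoc (f 0) (g ∘ suc) h m) (⋆-assoc (f ∘ suc) g h m) ⟩
  f 0 * g 0 * h (suc m) + (f 0 * (g ∘ suc ⋆ h) m + (f ∘ suc ⋆ (g ⋆ h)) m)
    ≡⟨ factor (f 0) (g 0) (h (suc m)) _ _ ⟩
  f 0 * (g 0 * h (suc m) + (g ∘ suc ⋆ h) m) + (f ∘ suc ⋆ (g ⋆ h)) m ∎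
  where
  open ≡-Reasoning
  factor : ∀ a b c x y → a * b * c + (a * x + y) ≡ a * (b * c + x) + y
  factor = solve-∀

⋆-unfoldʳ : ∀ f g m → (f ⋆ g) (suc m) ≡ (f ⋆ g ∘ suc) m + f (suc m) * g 0
⋆-unfoldʳ f g zero    = refl
⋆-unfoldʳ f g (suc m) = begin
  f 0 * g (2 ℕ.+ m) + (f ∘ suc ⋆ g) (suc m)
    ≡⟨ cong (λ y → f 0 * g (2 ℕ.+ m) + y) (⋆-unfoldʳ (f ∘ suc) g m) ⟩
  f 0 * g (2 ℕ.+ m) + ((f ∘ suc ⋆ g ∘ suc) m + f (2 ℕ.+ m) * g 0)
    ≡⟨ ℤP.+-assoc (f 0 * g (2 ℕ.+ m)) _ _ ⟨
  f 0 * g (2 ℕ.+ m) + (f ∘ suc ⋆ g ∘ suc) m + f (2 ℕ.+ m) * g 0 ∎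
  where open ≡-Reasoning

⋆-comm : ∀ f g → f ⋆ g ≗ g ⋆ f
⋆-comm f g zero    = ℤP.*-comm (f 0) (g 0)
⋆-comm f g (suc m) = begin
  f 0 * g (suc m) + (f ∘ suc ⋆ g) m ≡⟨ cong (λ y → f 0 * g (suc m) + y) (⋆-comm (f ∘ suc) g m) ⟩
  f 0 * g (suc m) + (g ⋆ f ∘ suc) m ≡⟨ ℤP.+-comm (f 0 * g (suc m)) _ ⟩
  (g ⋆ f ∘ suc) m + f 0 * g (suc m) ≡⟨ cong (λ y → (g ⋆ f ∘ suc) m + y) (ℤP.*-comm (f 0) (g (suc m))) ⟩
  (g ⋆ f ∘ suc) m + g (suc m) * f 0 ≡⟨ ⋆-unfoldʳ g f m ⟨
  (g ⋆ f) (suc m)                   ∎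
  where open ≡-Reasoning

⋆-isCommutativeSemigroup : IsCommutativeSemigroup _≗_ _⋆_
⋆-isCommutativeSemigroup = record
  { isSemigroup = record
    { isMagma = record
      { isEquivalence = Setoid.isEquivalence (ℕ →-setoid ℤ)
      ; ∙-cong        = ⋆-cong
      }
    ; assoc = ⋆-assoc
    }
  ; comm = ⋆-comm
  }

⋆-commutativeSemigroup : CommutativeSemigroup 0ℓ 0ℓ
⋆-commutativeSemigroup = record { isCommutativeSemigroup = ⋆-isCommutativeSemigroup }

open CommutativeSemigroupProperties ⋆-commutativeSemigroup using () renaming (interchange to ⋆-interchange)

sumUpTo-unfoldˡ : ∀ m F → sumUpTo (suc m) F ≡ F 0 + sumUpTo m (F ∘ suc)
sumUpTo-unfoldˡ zero    F = refl
sumUpTo-unfoldˡ (suc m) F = begin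
  sumUpTo (suc m) F + F (2 ℕ.+ m)                ≡⟨ cong (_+ F (2 ℕ.+ m)) (sumUpTo-unfoldˡ m F) ⟩
  F 0 + sumUpTo m (F ∘ suc) + F (2 ℕ.+ m)        ≡⟨ ℤP.+-assoc (F 0) _ _ ⟩
  F 0 + (sumUpTo m (F ∘ suc) + F (2 ℕ.+ m))      ∎
  where open ≡-Reasoning

sumUpTo-cong : ∀ m {F F′} → F ≗ F′ → sumUpTo m F ≡ sumUpTo m F′
sumUpTo-cong zero    F≗F′ = F≗F′ 0
sumUpTo-cong (suc m) F≗F′ = cong₂ _+_ (sumUpTo-cong m F≗F′) (F≗F′ (suc m))

sumUpTo-⋆ : ∀ f g m → sumUpTo m (λ j → f j * g (m ∸ j)) ≡ (f ⋆ g) m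
sumUpTo-⋆ f g zero    = refl
sumUpTo-⋆ f g (suc m) =
  trans (sumUpTo-unfoldˡ m (λ j → f j * g (suc m ∸ j)))
        (cong (λ y → f 0 * g (suc m) + y) (sumUpTo-⋆ (f ∘ suc) g m))

coeff-+P : ∀ p q → coeff (p +P q) ≗ coeff p +ₛ coeff q
coeff-+P []      q       m       = sym (ℤP.+-identityˡ (coeff q m))
coeff-+P (a ∷ p) []      m       = sym (ℤP.+-identityʳ (coeff (a ∷ p) m))
coeff-+P (a ∷ p) (b ∷ q) zero    = refl
coeff-+P (a ∷ p) (b ∷ q) (suc m) = coeff-+P p q m

coeff-map-* : ∀ a q → coeff (List.map (a *_) q) ≗ a ·ₛ coeff q
coeff-map-* a []      m       = sym (ℤP.*-zeroʳ a)
coeff-map-* a (b ∷ q) zero    = refl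
coeff-map-* a (b ∷ q) (suc m) = coeff-map-* a q m

coeff-*P : ∀ p q → coeff (p *P q) ≗ coeff p ⋆ coeff q
coeff-*P []      q m       = sym (⋆-zeroˡ (coeff q) m)
coeff-*P (a ∷ p) q zero    = begin
  coeff (List.map (a *_) q +P (0ℤ ∷ p *P q)) 0 ≡⟨ coeff-+P (List.map (a *_) q) _ 0 ⟩
  coeff (List.map (a *_) q) 0 + 0ℤ             ≡⟨ ℤP.+-identityʳ _ ⟩
  coeff (List.map (a *_) q) 0                  ≡⟨ coeff-map-* a q 0 ⟩
  a * coeff q 0                                ∎
  where open ≡-Reasoning
coeff-*P (a ∷ p) q (suc m) = begin
  coeff (List.map (a *_) q +P (0ℤ ∷ p *P q)) (suc m)  ≡⟨ coeff-+P (List.map (a *_) q) _ (suc m) ⟩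
  coeff (List.map (a *_) q) (suc m) + coeff (p *P q) m ≡⟨ cong₂ _+_ (coeff-map-* a q (suc m)) (coeff-*P p q m) ⟩
  a * coeff q (suc m) + (coeff p ⋆ coeff q) m          ∎
  where open ≡-Reasoning

binomial : ℕ → Series
binomial D j = sign j * + (D C j)

1-z : Series
1-z 0             = 1ℤ
1-z 1             = - 1ℤ
1-z (suc (suc _)) = 0ℤ

[1-z]⋆-suc : ∀ g m → (1-z ⋆ g) (suc m) ≡ g (suc m) - g m
[1-z]⋆-suc g zero    = cong₂ _+_ (ℤP.*-identityˡ (g 1)) (ℤP.-1*i≡-i (g 0))
[1-z]⋆-suc g (suc m) = begin
  1ℤ * g (2 ℕ.+ m) + (- 1ℤ * g (suc m) + (0ₛ ⋆ g) m)
    ≡⟨ cong₂ (λ x y → x + (- 1ℤ * g (suc m) + y)) (ℤP.*-identityˡ (g (2 ℕ.+ m))) (⋆-zeroˡ g m) ⟩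
  g (2 ℕ.+ m) + (- 1ℤ * g (suc m) + 0ℤ)
    ≡⟨ cong (λ y → g (2 ℕ.+ m) + y) (trans (ℤP.+-identityʳ _) (ℤP.-1*i≡-i (g (suc m)))) ⟩
  g (2 ℕ.+ m) - g (suc m) ∎
  where open ≡-Reasoning

binomial-zero : binomial 0 ≗ 1ₛ
binomial-zero zero    = refl
binomial-zero (suc j) = ℤP.*-zeroʳ (sign (suc j))

binomial-suc : ∀ D → binomial (suc D) ≗ 1-z ⋆ binomial D
binomial-suc D zero    = refl
binomial-suc D (suc j) = begin
  - sign j * + (suc D C suc j)           ≡⟨ cong (λ c → - sign j * + c) (nCk+nC[k+1]≡[n+1]C[k+1] D j) ⟨
  - sign j * (+ (D C j) + + (D C suc j)) ≡⟨ expand (sign j) (+ (D C j)) (+ (D C suc j)) ⟩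
  binomial D (suc j) - binomial D j      ≡⟨ [1-z]⋆-suc (binomial D) j ⟨
  (1-z ⋆ binomial D) (suc j)             ∎
  where
  open ≡-Reasoning
  expand : ∀ s a b → - s * (a + b) ≡ - s * b - s * a
  expand = solve-∀

binomial-+ : ∀ m n → binomial (m ℕ.+ n) ≗ binomial m ⋆ binomial n
binomial-+ zero    n = begin
  binomial n           ≈⟨ ⋆-identityˡ (binomial n) ⟨
  1ₛ ⋆ binomial n      ≈⟨ ⋆-cong binomial-zero (λ _ → refl) ⟨
  binomial 0 ⋆ binomial n ∎
  where open SetoidReasoning (ℕ →-setoid ℤ)
binomial-+ (suc m) n = begin
  binomial (suc (m ℕ.+ n))           ≈⟨ binomial-suc (m ℕ.+ n) ⟩
  1-z ⋆ binomial (m ℕ.+ n)            ≈⟨ ⋆-cong (λ _ → refl) (binomial-+ m n) ⟩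
  1-z ⋆ (binomial m ⋆ binomial n)     ≈⟨ ⋆-assoc 1-z (binomial m) (binomial n) ⟨
  1-z ⋆ binomial m ⋆ binomial n       ≈⟨ ⋆-cong (binomial-suc m) (λ _ → refl) ⟨
  binomial (suc m) ⋆ binomial n       ∎
  where open SetoidReasoning (ℕ →-setoid ℤ)

coeff-*P-binomial : ∀ {h k} D₁ D₂ {E₁ E₂ E} →
  coeff h ≗ binomial D₁ ⋆ E₁ → coeff k ≗ binomial D₂ ⋆ E₂ → E ≗ E₁ ⋆ E₂ →
  coeff (h *P k) ≗ binomial (D₁ ℕ.+ D₂) ⋆ E
coeff-*P-binomial {h} {k} D₁ D₂ {E₁} {E₂} {E} h≗ k≗ E≗ = begin
  coeff (h *P k)                             ≈⟨ coeff-*P h k ⟩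
  coeff h ⋆ coeff k                          ≈⟨ ⋆-cong h≗ k≗ ⟩
  (binomial D₁ ⋆ E₁) ⋆ (binomial D₂ ⋆ E₂)    ≈⟨ ⋆-interchange (binomial D₁) E₁ (binomial D₂) E₂ ⟩
  (binomial D₁ ⋆ binomial D₂) ⋆ (E₁ ⋆ E₂)    ≈⟨ ⋆-cong (binomial-+ D₁ D₂) E≗ ⟨
  binomial (D₁ ℕ.+ D₂) ⋆ E                   ∎
  where open SetoidReasoning (ℕ →-setoid ℤ)

tabulate-++ : ∀ {A : Set} m {n} (f : Fin (m ℕ.+ n) → A) →
  List.tabulate f ≡ List.tabulate (f ∘ (_↑ˡ n)) ++ List.tabulate (f ∘ (m ↑ʳ_))
tabulate-++ zero    f = refl
tabulate-++ (suc m) f = cong (f Fin.zero ∷_) (tabulate-++ m (f ∘ Fin.suc))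

concatMap-allFin-+ : ∀ {A : Set} m n (F : Fin (m ℕ.+ n) → List A) →
  concatMap F (allFin (m ℕ.+ n)) ≡
  concatMap (F ∘ (_↑ˡ n)) (allFin m) ++ concatMap (F ∘ (m ↑ʳ_)) (allFin n)
concatMap-allFin-+ m n F = begin
  concatMap F (allFin (m ℕ.+ n))
    ≡⟨ cong (concatMap F) (tabulate-++ m (λ i → i)) ⟩
  concatMap F (List.tabulate (_↑ˡ n) ++ List.tabulate (m ↑ʳ_))
    ≡⟨ ListP.concatMap-++ F (List.tabulate (_↑ˡ n)) _ ⟩
  concatMap F (List.tabulate (_↑ˡ n)) ++ concatMap F (List.tabulate (m ↑ʳ_))
    ≡⟨ cong₂ _++_ (cong (concatMap F) (ListP.map-tabulate (λ i → i) (_↑ˡ n)))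
                  (cong (concatMap F) (ListP.map-tabulate (λ i → i) (m ↑ʳ_))) ⟨
  concatMap F (List.map (_↑ˡ n) (allFin m)) ++ concatMap F (List.map (m ↑ʳ_) (allFin n))
    ≡⟨ cong₂ _++_ (ListP.concatMap-map F (_↑ˡ n) (allFin m)) (ListP.concatMap-map F (m ↑ʳ_) (allFin n)) ⟩
  concatMap (F ∘ (_↑ˡ n)) (allFin m) ++ concatMap (F ∘ (m ↑ʳ_)) (allFin n) ∎
  where open ≡-Reasoning

length-cartesianProductWith : ∀ {A B C : Set} (f : A → B → C) xs ys →
  length (cartesianProductWith f xs ys) ≡ length xs ℕ.* length ys
length-cartesianProductWith f []       ys = refl
length-cartesianProductWith f (x ∷ xs) ys = begin
  length (List.map (f x) ys ++ cartesianProductWith f xs ys)      ≡⟨ ListP.length-++ (List.map (f x) ys) ⟩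
  length (List.map (f x) ys) ℕ.+ length (cartesianProductWith f xs ys)
    ≡⟨ cong₂ ℕ._+_ (ListP.length-map (f x) ys) (length-cartesianProductWith f xs ys) ⟩
  length ys ℕ.+ length xs ℕ.* length ys                           ∎
  where open ≡-Reasoning

map-cancel : ∀ {A B : Set} {f : A → B} {g : B → A} → (∀ x → g (f x) ≡ x) →
  ∀ xs → List.map g (List.map f xs) ≡ xs
map-cancel g∘f≗id xs = trans (sym (ListP.map-∘ xs)) (trans (ListP.map-cong g∘f≗id xs) (ListP.map-id xs))

module _ {A B C : Set} (f : A → B → C) where

  convolveWith : (ℕ → List A) → (ℕ → List B) → ℕ → List C
  convolveWith X Y zero    = cartesianProductWith f (X 0) (Y 0)
  convolveWith X Y (suc t) = cartesianProductWith f (X 0) (Y (suc t)) ++ convolveWith (X ∘ suc) Y t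

  ∈-convolveWith⁺ : ∀ X Y a b {x y} → x ∈ X a → y ∈ Y b → f x y ∈ convolveWith X Y (a ℕ.+ b)
  ∈-convolveWith⁺ X Y zero    zero    x∈ y∈ = ∈-cartesianProductWith⁺ f x∈ y∈
  ∈-convolveWith⁺ X Y zero    (suc b) x∈ y∈ = ∈-++⁺ˡ (∈-cartesianProductWith⁺ f x∈ y∈)
  ∈-convolveWith⁺ X Y (suc a) b       x∈ y∈ =
    ∈-++⁺ʳ (cartesianProductWith f (X 0) (Y (suc (a ℕ.+ b)))) (∈-convolveWith⁺ (X ∘ suc) Y a b x∈ y∈)

  ∈-convolveWith⁻ : ∀ X Y t {z} → z ∈ convolveWith X Y t →
    ∃₂ λ a b → a ℕ.+ b ≡ t × ∃₂ λ x y → x ∈ X a × y ∈ Y b × z ≡ f x y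
  ∈-convolveWith⁻ X Y zero z∈ = 0 , 0 , refl , ∈-cartesianProductWith⁻ f (X 0) (Y 0) z∈
  ∈-convolveWith⁻ X Y (suc t) z∈ with ∈-++⁻ (cartesianProductWith f (X 0) (Y (suc t))) z∈
  ... | inj₁ z∈₀ = 0 , suc t , refl , ∈-cartesianProductWith⁻ f (X 0) (Y (suc t)) z∈₀
  ... | inj₂ z∈₊ =
    let a , b , a+b≡t , rest = ∈-convolveWith⁻ (X ∘ suc) Y t z∈₊ in suc a , b , cong suc a+b≡t , rest

  convolveWith-unique : ∀ X Y → (∀ {w x y z} → f w y ≡ f x z → w ≡ x × y ≡ z) →
    (∀ a → Unique (X a)) → (∀ b → Unique (Y b)) → (∀ {a a′ x} → x ∈ X a → x ∈ X a′ → a ≡ a′) →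
    ∀ t → Unique (convolveWith X Y t)
  convolveWith-unique X Y f-inj uX uY X-disjoint zero =
    Unique.cartesianProductWith⁺ f f-inj (uX 0) (uY 0)
  convolveWith-unique X Y f-inj uX uY X-disjoint (suc t) =
    Unique.++⁺ (Unique.cartesianProductWith⁺ f f-inj (uX 0) (uY (suc t)))
               (convolveWith-unique (X ∘ suc) Y f-inj (uX ∘ suc) uY
                  (λ p q → ℕP.suc-injective (X-disjoint p q)) t)
               disjoint
    where
    disjoint : ∀ {z} → ¬ (z ∈ cartesianProductWith f (X 0) (Y (suc t)) × z ∈ convolveWith (X ∘ suc) Y t)
    disjoint (z∈₀ , z∈₊)
      with ∈-cartesianProductWith⁻ f (X 0) (Y (suc t)) z∈₀ | ∈-convolveWith⁻ (X ∘ suc) Y t z∈₊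
    ... | x , _ , x∈ , _ , refl | a , _ , _ , x′ , _ , x′∈ , _ , fxy≡
      with X-disjoint x∈ (subst (_∈ X (suc a)) (sym (proj₁ (f-inj fxy≡))) x′∈)
    ... | ()

  length-convolveWith : ∀ X Y t →
    + length (convolveWith X Y t) ≡ ((+_ ∘ length ∘ X) ⋆ (+_ ∘ length ∘ Y)) t
  length-convolveWith X Y zero =
    trans (cong +_ (length-cartesianProductWith f (X 0) (Y 0))) (ℤP.pos-* (length (X 0)) (length (Y 0)))
  length-convolveWith X Y (suc t) = begin
    + length (XY ++ convolveWith (X ∘ suc) Y t)
      ≡⟨ cong +_ (ListP.length-++ XY) ⟩
    + (length XY ℕ.+ length (convolveWith (X ∘ suc) Y t))
      ≡⟨ ℤP.pos-+ (length XY) _ ⟩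
    + length XY + + length (convolveWith (X ∘ suc) Y t)
      ≡⟨ cong₂ _+_ lengthXY (length-convolveWith (X ∘ suc) Y t) ⟩
    + length (X 0) * + length (Y (suc t)) + ((+_ ∘ length ∘ X ∘ suc) ⋆ (+_ ∘ length ∘ Y)) t ∎
    where
    open ≡-Reasoning
    XY = cartesianProductWith f (X 0) (Y (suc t))
    lengthXY : + length XY ≡ + length (X 0) * + length (Y (suc t))
    lengthXY = trans (cong +_ (length-cartesianProductWith f (X 0) (Y (suc t))))
                     (ℤP.pos-* (length (X 0)) (length (Y (suc t))))

toℚ≡mkℚ : ∀ z → toℚ z ≡ mkℚ z 0 (Coprimality.sym (Coprimality.1-coprimeTo ℤ.∣ z ∣))
toℚ≡mkℚ z = ℚP.↥p/↧p≡p (mkℚ z 0 _)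

toℚ-injective : ∀ {a b} → toℚ a ≡ toℚ b → a ≡ b
toℚ-injective {a} {b} eq = cong ℚ.↥_ (trans (sym (toℚ≡mkℚ a)) (trans eq (toℚ≡mkℚ b)))

toℚ-+ : ∀ a b → toℚ (a + b) ≡ toℚ a ℚ.+ toℚ b
toℚ-+ a b rewrite toℚ≡mkℚ a | toℚ≡mkℚ b =
  cong (ℚ._/ 1) (sym (cong₂ _+_ (ℤP.*-identityʳ a) (ℤP.*-identityʳ b)))

0≤toℚ⇒ℕ : ∀ z → 0ℚ ℚ.≤ toℚ z → ∃ λ n → z ≡ + n
0≤toℚ⇒ℕ z 0≤z rewrite toℚ≡mkℚ z = nonNegative z 0≤z
  where
  nonNegative : ∀ z .{c : Coprimality.Coprime ℤ.∣ z ∣ 1} → 0ℚ ℚ.≤ mkℚ z 0 c → ∃ λ n → z ≡ + n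
  nonNegative (+ n)    _            = n , refl
  nonNegative -[1+ n ] (ℚ.*≤* ())

origin : ∀ {N} → Pt N
origin = tabulate (const 0ℤ)

toℚᵛ : ∀ {N} → Pt N → Fin N → ℚ
toℚᵛ p α = toℚ (lookup p α)

toℚᵛ-injective : ∀ {N} {p q : Pt N} → toℚᵛ p ≗ toℚᵛ q → p ≡ q
toℚᵛ-injective p≗q = Pointwise-≡⇒≡ (ext (toℚ-injective ∘ p≗q))

coordSum : ∀ {N} → Pt N → ℤ
coordSum = Vec.foldr _ _+_ 0ℤ

coordSum-+ᵥ : ∀ {N} (u v : Pt N) → coordSum (u +ᵥ v) ≡ coordSum u + coordSum v
coordSum-+ᵥ Vec.[]      Vec.[]      = refl
coordSum-+ᵥ (a Vec.∷ u) (b Vec.∷ v) = trans (cong (λ s → a + b + s) (coordSum-+ᵥ u v)) (regroup a b _ _)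
  where
  regroup : ∀ a b x y → a + b + (x + y) ≡ a + x + (b + y)
  regroup = solve-∀

coordSum-[-ᵥ] : ∀ {N} (u v : Pt N) → coordSum (u -ᵥ v) ≡ coordSum u - coordSum v
coordSum-[-ᵥ] Vec.[]      Vec.[]      = refl
coordSum-[-ᵥ] (a Vec.∷ u) (b Vec.∷ v) = trans (cong (λ s → a - b + s) (coordSum-[-ᵥ] u v)) (regroup a b _ _)
  where
  regroup : ∀ a b x y → a - b + (x - y) ≡ a + x - (b + y)
  regroup = solve-∀

coordSum-origin : ∀ N → coordSum (origin {N}) ≡ 0ℤ
coordSum-origin zero    = refl
coordSum-origin (suc N) = cong (_+_ 0ℤ) (coordSum-origin N)

lookup-unit : ∀ {N} (a β : Fin N) → lookup (unit a) β ≡ (if ⌊ a ≟F β ⌋ then 1ℤ else 0ℤ)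
lookup-unit a = VecP.lookup∘tabulate (λ β → if ⌊ a ≟F β ⌋ then 1ℤ else 0ℤ)

lookup-unit-self : ∀ {N} (a : Fin N) → lookup (unit a) a ≡ 1ℤ
lookup-unit-self a with a ≟F a | lookup-unit a a
... | yes _   | eq = eq
... | no a≢a | _  = contradiction refl a≢a

lookup-unit-other : ∀ {N} {a β : Fin N} → a ≢ β → lookup (unit a) β ≡ 0ℤ
lookup-unit-other {a = a} {β} a≢β with a ≟F β | lookup-unit a β
... | yes a≡β | _  = contradiction a≡β a≢β
... | no _    | eq = eq

unit-unique : ∀ {N} {b : Fin N} {v : Pt N} →
  lookup v b ≡ 1ℤ → (∀ β → b ≢ β → lookup v β ≡ 0ℤ) → v ≡ unit b
unit-unique {b = b} {v} v[b]≡1 v[β]≡0 = Pointwise-≡⇒≡ (ext lookup-v)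
  where
  lookup-v : ∀ β → lookup v β ≡ lookup (unit b) β
  lookup-v β with b ≟F β
  ... | yes refl = trans v[b]≡1 (sym (lookup-unit-self b))
  ... | no b≢β   = trans (v[β]≡0 β b≢β) (sym (lookup-unit-other b≢β))

unit-suc : ∀ {N} (a : Fin N) → unit (Fin.suc a) ≡ 0ℤ Vec.∷ unit a
unit-suc a = sym (unit-unique (lookup-unit-self a) tail≡0)
  where
  tail≡0 : ∀ β → Fin.suc a ≢ β → lookup (0ℤ Vec.∷ unit a) β ≡ 0ℤ
  tail≡0 Fin.zero    _     = refl
  tail≡0 (Fin.suc β) sa≢sβ = lookup-unit-other (sa≢sβ ∘ cong Fin.suc)

coordSum-unit : ∀ {N} (a : Fin N) → coordSum (unit a) ≡ 1ℤ
coordSum-unit {suc N} Fin.zero    = cong (_+_ 1ℤ) (coordSum-origin N)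
coordSum-unit {suc N} (Fin.suc a) =
  trans (cong coordSum (unit-suc a)) (trans (ℤP.+-identityˡ (coordSum (unit a))) (coordSum-unit a))

-- The linear map sending e α to the sum of the e β with ρ β ≡ just α: relabellings of
-- coordinates, embeddings of a block of coordinates and projections onto it are all of this form.
reindex : ∀ {M N} → (Fin N → Maybe (Fin M)) → Pt M → Pt N
reindex ρ p = tabulate (λ β → maybe (lookup p) 0ℤ (ρ β))

reindexℚ : ∀ {M N} → (Fin N → Maybe (Fin M)) → (Fin M → ℚ) → Fin N → ℚ
reindexℚ ρ x β = maybe x 0ℚ (ρ β)

lookup-reindex : ∀ {M N} (ρ : Fin N → Maybe (Fin M)) p β → lookup (reindex ρ p) β ≡ maybe (lookup p) 0ℤ (ρ β)
lookup-reindex ρ p = VecP.lookup∘tabulate (λ β → maybe (lookup p) 0ℤ (ρ β))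

toℚᵛ-reindex : ∀ {M N} (ρ : Fin N → Maybe (Fin M)) p → toℚᵛ (reindex ρ p) ≗ reindexℚ ρ (toℚᵛ p)
toℚᵛ-reindex ρ p β = trans (cong toℚ (lookup-reindex ρ p β)) (toℚ-maybe (ρ β))
  where
  toℚ-maybe : ∀ m → toℚ (maybe (lookup p) 0ℤ m) ≡ maybe (toℚᵛ p) 0ℚ m
  toℚ-maybe (just α) = refl
  toℚ-maybe nothing  = refl

reindex-zipWith : ∀ {M N} (ρ : Fin N → Maybe (Fin M)) (_∙_ : ℤ → ℤ → ℤ) → 0ℤ ∙ 0ℤ ≡ 0ℤ →
  ∀ u v → reindex ρ (zipWith _∙_ u v) ≡ zipWith _∙_ (reindex ρ u) (reindex ρ v)
reindex-zipWith ρ _∙_ 0∙0≡0 u v = Pointwise-≡⇒≡ (ext lookup-≡)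
  where
  maybe-∙ : ∀ m → maybe (lookup (zipWith _∙_ u v)) 0ℤ m ≡ maybe (lookup u) 0ℤ m ∙ maybe (lookup v) 0ℤ m
  maybe-∙ (just α) = VecP.lookup-zipWith _∙_ α u v
  maybe-∙ nothing  = sym 0∙0≡0
  lookup-≡ : ∀ β → lookup (reindex ρ (zipWith _∙_ u v)) β ≡ lookup (zipWith _∙_ (reindex ρ u) (reindex ρ v)) β
  lookup-≡ β = begin
    lookup (reindex ρ (zipWith _∙_ u v)) β
      ≡⟨ lookup-reindex ρ (zipWith _∙_ u v) β ⟩
    maybe (lookup (zipWith _∙_ u v)) 0ℤ (ρ β)
      ≡⟨ maybe-∙ (ρ β) ⟩
    maybe (lookup u) 0ℤ (ρ β) ∙ maybe (lookup v) 0ℤ (ρ β)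
      ≡⟨ cong₂ _∙_ (lookup-reindex ρ u β) (lookup-reindex ρ v β) ⟨
    lookup (reindex ρ u) β ∙ lookup (reindex ρ v) β
      ≡⟨ VecP.lookup-zipWith _∙_ β (reindex ρ u) (reindex ρ v) ⟨
    lookup (zipWith _∙_ (reindex ρ u) (reindex ρ v)) β ∎
    where open ≡-Reasoning

reindex-unit : ∀ {M N} {ρ : Fin N → Maybe (Fin M)} {a b} →
  ρ b ≡ just a → (∀ β → ρ β ≡ just a → β ≡ b) → reindex ρ (unit a) ≡ unit b
reindex-unit {ρ = ρ} {a} {b} ρb≡a ρβ≡a⇒β≡b = unit-unique at-b off-b
  where
  at-b : lookup (reindex ρ (unit a)) b ≡ 1ℤ
  at-b = trans (lookup-reindex ρ (unit a) b)
               (trans (cong (maybe (lookup (unit a)) 0ℤ) ρb≡a) (lookup-unit-self a))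
  off : ∀ β m → ρ β ≡ m → b ≢ β → maybe (lookup (unit a)) 0ℤ m ≡ 0ℤ
  off β nothing  _   _   = refl
  off β (just γ) ρβ≡ b≢β with a ≟F γ
  ... | yes refl = contradiction (sym (ρβ≡a⇒β≡b β ρβ≡)) b≢β
  ... | no a≢γ   = lookup-unit-other a≢γ
  off-b : ∀ β → b ≢ β → lookup (reindex ρ (unit a)) β ≡ 0ℤ
  off-b β b≢β = trans (lookup-reindex ρ (unit a) β) (off β (ρ β) refl b≢β)

reindex-cancel : ∀ {M N} (ρ : Fin M → Maybe (Fin N)) (σ : Fin N → Maybe (Fin M)) →
  (∀ α → (ρ α >>= σ) ≡ just α) → ∀ p → reindex ρ (reindex σ p) ≡ p
reindex-cancel ρ σ ρσ≡just p = trans (VecP.tabulate-cong lookup-≡) (VecP.tabulate∘lookup p)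
  where
  cancel : ∀ α m → (m >>= σ) ≡ just α → maybe (lookup (reindex σ p)) 0ℤ m ≡ lookup p α
  cancel α (just β) σβ≡α = trans (lookup-reindex σ p β) (cong (maybe (lookup p) 0ℤ) σβ≡α)
  lookup-≡ : ∀ α → maybe (lookup (reindex σ p)) 0ℤ (ρ α) ≡ lookup p α
  lookup-≡ α = cancel α (ρ α) (ρσ≡just α)

open CommutativeSemigroupProperties (CommutativeMonoid.commutativeSemigroup ℚP.+-0-commutativeMonoid)
  using () renaming (interchange to ℚ-+-interchange)

0*x+y≡y : ∀ x y → 0ℚ ℚ.* x ℚ.+ y ≡ y
0*x+y≡y x y = trans (cong (ℚ._+ y) (ℚP.*-zeroˡ x)) (ℚP.+-identityˡ y)

x*0+0≡0 : ∀ x → x ℚ.* 0ℚ ℚ.+ 0ℚ ≡ 0ℚ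
x*0+0≡0 x = trans (ℚP.+-identityʳ (x ℚ.* 0ℚ)) (ℚP.*-zeroʳ x)

nonNegative-+-zeroˡ : ∀ {a b} → 0ℚ ℚ.≤ a → 0ℚ ℚ.≤ b → a ℚ.+ b ≡ 0ℚ → a ≡ 0ℚ
nonNegative-+-zeroˡ {a} {b} 0≤a 0≤b a+b≡0 = ℚP.≤-antisym a≤0 0≤a
  where
  a≤0 : a ℚ.≤ 0ℚ
  a≤0 = subst₂ ℚ._≤_ (ℚP.+-identityʳ a) a+b≡0 (ℚP.+-monoʳ-≤ a 0≤b)

sumFin-cong : ∀ {m} {f g : Fin m → ℚ} → f ≗ g → sumFin f ≡ sumFin g
sumFin-cong {zero}  f≗g = refl
sumFin-cong {suc m} f≗g = cong₂ ℚ._+_ (f≗g Fin.zero) (sumFin-cong (f≗g ∘ Fin.suc))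

sumFin-zero : ∀ m → sumFin {m} (const 0ℚ) ≡ 0ℚ
sumFin-zero zero    = refl
sumFin-zero (suc m) = trans (cong (0ℚ ℚ.+_) (sumFin-zero m)) (ℚP.+-identityˡ 0ℚ)

sumFin-linear : ∀ {m} a (f g : Fin m → ℚ) →
  sumFin (λ α → a ℚ.* f α ℚ.+ g α) ≡ a ℚ.* sumFin f ℚ.+ sumFin g
sumFin-linear {zero}  a f g = sym (x*0+0≡0 a)
sumFin-linear {suc m} a f g = begin
  (a ℚ.* f Fin.zero ℚ.+ g Fin.zero) ℚ.+ sumFin (λ α → a ℚ.* f (Fin.suc α) ℚ.+ g (Fin.suc α))
    ≡⟨ cong (a ℚ.* f Fin.zero ℚ.+ g Fin.zero ℚ.+_) (sumFin-linear a (f ∘ Fin.suc) (g ∘ Fin.suc)) ⟩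
  (a ℚ.* f Fin.zero ℚ.+ g Fin.zero) ℚ.+ (a ℚ.* sumFin (f ∘ Fin.suc) ℚ.+ sumFin (g ∘ Fin.suc))
    ≡⟨ ℚ-+-interchange (a ℚ.* f Fin.zero) _ _ _ ⟩
  (a ℚ.* f Fin.zero ℚ.+ a ℚ.* sumFin (f ∘ Fin.suc)) ℚ.+ (g Fin.zero ℚ.+ sumFin (g ∘ Fin.suc))
    ≡⟨ cong (ℚ._+ sumFin g) (ℚP.*-distribˡ-+ a (f Fin.zero) _) ⟨
  a ℚ.* sumFin f ℚ.+ sumFin g ∎
  where open ≡-Reasoning

sumFin-toℚᵛ : ∀ {N} (p : Pt N) → sumFin (toℚᵛ p) ≡ toℚ (coordSum p)
sumFin-toℚᵛ Vec.[]       = refl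
sumFin-toℚᵛ (z Vec.∷ p) = trans (cong (toℚ z ℚ.+_) (sumFin-toℚᵛ p)) (sym (toℚ-+ z (coordSum p)))

-- Conic combinations

-- InDilate pts t x unfolds to Weighted pts (toℚ (+ t)) (toℚᵛ x).
Weighted : ∀ {N} → List (Pt N) → ℚ → (Fin N → ℚ) → Set
Weighted {N} pts s x =
  Σ (Fin (length pts) → ℚ) λ lam →
    ((p : Fin (length pts)) → 0ℚ ℚ.≤ lam p) ×
    (sumFin lam ≡ s) ×
    ((α : Fin N) → sumFin (λ p → lam p ℚ.* toℚ (lookup (List.lookup pts p) α)) ≡ x α)

data Conic {N} : List (Pt N) → ℚ → (Fin N → ℚ) → Set where
  nil  : ∀ {s x} → s ≡ 0ℚ → x ≗ const 0ℚ → Conic [] s x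
  cons : ∀ {p ps s x} a {s′ x′} → 0ℚ ℚ.≤ a → s ≡ a ℚ.+ s′ → x ≗ (λ α → a ℚ.* toℚᵛ p α ℚ.+ x′ α) →
         Conic ps s′ x′ → Conic (p ∷ ps) s x

module _ {N : ℕ} where

  weighted⇒conic : ∀ (ps : List (Pt N)) {s x} → Weighted ps s x → Conic ps s x
  weighted⇒conic []       (lam , _ , Σlam≡s , Σ≡x) = nil (sym Σlam≡s) (sym ∘ Σ≡x)
  weighted⇒conic (p ∷ ps) (lam , lam≥0 , Σlam≡s , Σ≡x) =
    cons (lam Fin.zero) (lam≥0 Fin.zero) (sym Σlam≡s) (sym ∘ Σ≡x)
         (weighted⇒conic ps (lam ∘ Fin.suc , lam≥0 ∘ Fin.suc , refl , λ _ → refl))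

  conic⇒weighted : ∀ {ps : List (Pt N)} {s x} → Conic ps s x → Weighted ps s x
  conic⇒weighted (nil s≡0 x≗0) = (λ ()) , (λ ()) , sym s≡0 , sym ∘ x≗0
  conic⇒weighted {p ∷ ps} (cons a a≥0 s≡ x≗ c) with conic⇒weighted c
  ... | lam , lam≥0 , Σlam≡s , Σ≡x =
    a VecF.∷ lam , nonNegative , trans (cong (a ℚ.+_) Σlam≡s) (sym s≡) ,
    λ α → trans (cong (a ℚ.* toℚᵛ p α ℚ.+_) (Σ≡x α)) (sym (x≗ α))
    where
    nonNegative : ∀ i → 0ℚ ℚ.≤ (a VecF.∷ lam) i
    nonNegative Fin.zero    = a≥0
    nonNegative (Fin.suc i) = lam≥0 i

  conic-cong : ∀ {ps : List (Pt N)} {s s′ x x′} → s ≡ s′ → x ≗ x′ → Conic ps s x → Conic ps s′ x′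
  conic-cong refl x≗x′ (nil s≡0 x≗0)          = nil s≡0 (λ α → trans (sym (x≗x′ α)) (x≗0 α))
  conic-cong refl x≗x′ (cons a a≥0 s≡ x≗ c) = cons a a≥0 s≡ (λ α → trans (sym (x≗x′ α)) (x≗ α)) c

  conic-zero : ∀ (ps : List (Pt N)) → Conic ps 0ℚ (const 0ℚ)
  conic-zero []       = nil refl (λ _ → refl)
  conic-zero (p ∷ ps) = cons 0ℚ ℚP.≤-refl refl (λ α → sym (0*x+y≡y (toℚᵛ p α) 0ℚ)) (conic-zero ps)

  conic-+ : ∀ {ps : List (Pt N)} {s s′ x x′} → Conic ps s x → Conic ps s′ x′ →
    Conic ps (s ℚ.+ s′) (λ α → x α ℚ.+ x′ α)
  conic-+ (nil s≡0 x≗0) (nil s′≡0 x′≗0) =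
    nil (cong₂ ℚ._+_ s≡0 s′≡0) (λ α → cong₂ ℚ._+_ (x≗0 α) (x′≗0 α))
  conic-+ {p ∷ _} (cons a a≥0 s≡ x≗ c) (cons b b≥0 s′≡ x′≗ d) =
    cons (a ℚ.+ b) (ℚP.+-mono-≤ a≥0 b≥0)
         (trans (cong₂ ℚ._+_ s≡ s′≡) (ℚ-+-interchange a _ b _))
         (λ α → trans (cong₂ ℚ._+_ (x≗ α) (x′≗ α)) (distrib α))
         (conic-+ c d)
    where
    distrib : ∀ α → (a ℚ.* toℚᵛ p α ℚ.+ _) ℚ.+ (b ℚ.* toℚᵛ p α ℚ.+ _) ≡ (a ℚ.+ b) ℚ.* toℚᵛ p α ℚ.+ _
    distrib α = trans (ℚ-+-interchange (a ℚ.* toℚᵛ p α) _ _ _)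
                      (cong (ℚ._+ _) (sym (ℚP.*-distribʳ-+ (toℚᵛ p α) a b)))

  conic-∈ : ∀ {ps : List (Pt N)} {p a} → p ∈ ps → 0ℚ ℚ.≤ a → Conic ps a (λ α → a ℚ.* toℚᵛ p α)
  conic-∈ {_ ∷ ps} {a = a} (here refl) a≥0 =
    cons a a≥0 (sym (ℚP.+-identityʳ a)) (λ α → sym (ℚP.+-identityʳ _)) (conic-zero ps)
  conic-∈ {q ∷ _} {a = a} (there p∈) a≥0 =
    cons 0ℚ ℚP.≤-refl (sym (ℚP.+-identityˡ a)) (λ α → sym (0*x+y≡y (toℚᵛ q α) _)) (conic-∈ p∈ a≥0)

  conic-⊆ : ∀ {ps qs : List (Pt N)} {s x} → ps ⊆ qs → Conic ps s x → Conic qs s x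
  conic-⊆ {qs = qs} _ (nil s≡0 x≗0) = conic-cong (sym s≡0) (sym ∘ x≗0) (conic-zero qs)
  conic-⊆ ps⊆qs (cons a a≥0 s≡ x≗ c) =
    conic-cong (sym s≡) (sym ∘ x≗) (conic-+ (conic-∈ (ps⊆qs (here refl)) a≥0) (conic-⊆ (ps⊆qs ∘ there) c))

  conic-++⁺ : ∀ {ps qs : List (Pt N)} {s s′ x x′} → Conic ps s x → Conic qs s′ x′ →
    Conic (ps ++ qs) (s ℚ.+ s′) (λ α → x α ℚ.+ x′ α)
  conic-++⁺ {ps} c d = conic-+ (conic-⊆ ∈-++⁺ˡ c) (conic-⊆ (∈-++⁺ʳ ps) d)

  conic-++⁻ : ∀ (ps : List (Pt N)) {qs s x} → Conic (ps ++ qs) s x →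
    ∃₂ λ s₁ s₂ → ∃₂ λ x₁ x₂ →
      s ≡ s₁ ℚ.+ s₂ × x ≗ (λ α → x₁ α ℚ.+ x₂ α) × Conic ps s₁ x₁ × Conic qs s₂ x₂
  conic-++⁻ [] {s = s} {x} c =
    0ℚ , s , const 0ℚ , x , sym (ℚP.+-identityˡ s) , (sym ∘ ℚP.+-identityˡ ∘ x) , nil refl (λ _ → refl) , c
  conic-++⁻ (p ∷ ps) (cons a a≥0 s≡ x≗ c) with conic-++⁻ ps c
  ... | s₁ , s₂ , x₁ , x₂ , s′≡ , x′≗ , c₁ , c₂ =
    a ℚ.+ s₁ , s₂ , (λ α → a ℚ.* toℚᵛ p α ℚ.+ x₁ α) , x₂ ,
    trans s≡ (trans (cong (a ℚ.+_) s′≡) (sym (ℚP.+-assoc a s₁ s₂))) ,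
    (λ α → trans (x≗ α) (trans (cong (a ℚ.* toℚᵛ p α ℚ.+_) (x′≗ α))
                               (sym (ℚP.+-assoc (a ℚ.* toℚᵛ p α) (x₁ α) (x₂ α))))) ,
    cons a a≥0 refl (λ _ → refl) c₁ , c₂

  conic-weight-nonNegative : ∀ {ps : List (Pt N)} {s x} → Conic ps s x → 0ℚ ℚ.≤ s
  conic-weight-nonNegative (nil refl _)           = ℚP.≤-refl
  conic-weight-nonNegative (cons a a≥0 refl _ c) = ℚP.+-mono-≤ a≥0 (conic-weight-nonNegative c)

  conic-weight-zero : ∀ {ps : List (Pt N)} {x} → Conic ps 0ℚ x → x ≗ const 0ℚ
  conic-weight-zero (nil _ x≗0) = x≗0
  conic-weight-zero {p ∷ _} {x} (cons a {s′} a≥0 0≡a+s′ x≗ c) α = begin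
    x α                     ≡⟨ x≗ α ⟩
    a ℚ.* toℚᵛ p α ℚ.+ _   ≡⟨ cong₂ (λ b y → b ℚ.* toℚᵛ p α ℚ.+ y) a≡0 x′α≡0 ⟩
    0ℚ ℚ.* toℚᵛ p α ℚ.+ 0ℚ ≡⟨ 0*x+y≡y (toℚᵛ p α) 0ℚ ⟩
    0ℚ                      ∎
    where
    open ≡-Reasoning
    s′≥0 = conic-weight-nonNegative c
    a≡0 : a ≡ 0ℚ
    a≡0 = nonNegative-+-zeroˡ a≥0 s′≥0 (sym 0≡a+s′)
    s′≡0 : s′ ≡ 0ℚ
    s′≡0 = nonNegative-+-zeroˡ s′≥0 a≥0 (trans (ℚP.+-comm s′ a) (sym 0≡a+s′))
    x′α≡0 = conic-weight-zero (conic-cong s′≡0 (λ _ → refl) c) α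

  conic-vanish : ∀ {ps : List (Pt N)} {s x} α → (∀ {p} → p ∈ ps → lookup p α ≡ 0ℤ) → Conic ps s x → x α ≡ 0ℚ
  conic-vanish α _ (nil _ x≗0) = x≗0 α
  conic-vanish {p ∷ _} {x = x} α ps[α]≡0 (cons a {x′ = x′} _ _ x≗ c) = begin
    x α                          ≡⟨ x≗ α ⟩
    a ℚ.* toℚᵛ p α ℚ.+ x′ α     ≡⟨ cong₂ (λ z y → a ℚ.* toℚ z ℚ.+ y)
                                          (ps[α]≡0 (here refl)) (conic-vanish α (ps[α]≡0 ∘ there) c) ⟩
    a ℚ.* 0ℚ ℚ.+ 0ℚ             ≡⟨ x*0+0≡0 a ⟩
    0ℚ                           ∎
    where open ≡-Reasoning

  CoordSumOne : List (Pt N) → Set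
  CoordSumOne ps = ∀ {p} → p ∈ ps → coordSum p ≡ 1ℤ

  conic-sumFin : ∀ {ps : List (Pt N)} {s x} → CoordSumOne ps → Conic ps s x → sumFin x ≡ s
  conic-sumFin _ (nil s≡0 x≗0) = trans (sumFin-cong x≗0) (trans (sumFin-zero N) (sym s≡0))
  conic-sumFin {p ∷ _} {s} {x} ps≡1 (cons a {s′} {x′} _ s≡ x≗ c) = begin
    sumFin x                                   ≡⟨ sumFin-cong x≗ ⟩
    sumFin (λ α → a ℚ.* toℚᵛ p α ℚ.+ x′ α)     ≡⟨ sumFin-linear a (toℚᵛ p) x′ ⟩
    a ℚ.* sumFin (toℚᵛ p) ℚ.+ sumFin x′        ≡⟨ cong₂ (λ y z → a ℚ.* y ℚ.+ z) p-sum (conic-sumFin (ps≡1 ∘ there) c) ⟩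
    a ℚ.* toℚ 1ℤ ℚ.+ s′                        ≡⟨ cong (ℚ._+ s′) (ℚP.*-identityʳ a) ⟩
    a ℚ.+ s′                                   ≡⟨ s≡ ⟨
    s                                          ∎
    where
    open ≡-Reasoning
    p-sum : sumFin (toℚᵛ p) ≡ toℚ 1ℤ
    p-sum = trans (sumFin-toℚᵛ p) (cong toℚ (ps≡1 (here refl)))

conic-reindex : ∀ {M N} (ρ : Fin N → Maybe (Fin M)) {ps s x} →
  Conic ps s x → Conic (List.map (reindex ρ) ps) s (reindexℚ ρ x)
conic-reindex ρ (nil s≡0 x≗0) = nil s≡0 (reindexℚ-zero ∘ ρ)
  where
  reindexℚ-zero : ∀ m → maybe _ 0ℚ m ≡ 0ℚ
  reindexℚ-zero (just α) = x≗0 α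
  reindexℚ-zero nothing  = refl
conic-reindex ρ {p ∷ _} (cons a {x′ = x′} a≥0 s≡ x≗ c) =
  cons a a≥0 s≡ (λ β → trans (reindexℚ-linear (ρ β)) (cong (λ y → a ℚ.* y ℚ.+ _) (sym (toℚᵛ-reindex ρ p β))))
       (conic-reindex ρ c)
  where
  reindexℚ-linear : ∀ m → maybe _ 0ℚ m ≡ a ℚ.* maybe (toℚᵛ p) 0ℚ m ℚ.+ maybe x′ 0ℚ m
  reindexℚ-linear (just α) = x≗ α
  reindexℚ-linear nothing  = sym (x*0+0≡0 a)

conic-coordSum : ∀ {N} {ps : List (Pt N)} {s x} → CoordSumOne ps → Conic ps s (toℚᵛ x) → s ≡ toℚ (coordSum x)
conic-coordSum {x = x} ps≡1 c = trans (sym (conic-sumFin ps≡1 c)) (sumFin-toℚᵛ x)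

conic-weight-ℕ : ∀ {N} {ps : List (Pt N)} {s x} → CoordSumOne ps → Conic ps s (toℚᵛ x) → ∃ λ a → s ≡ toℚ (+ a)
conic-weight-ℕ {x = x} ps≡1 c
  with 0≤toℚ⇒ℕ (coordSum x) (subst (0ℚ ℚ.≤_) (conic-coordSum {x = x} ps≡1 c) (conic-weight-nonNegative c))
... | a , coordSum≡a = a , trans (conic-coordSum {x = x} ps≡1 c) (cong toℚ coordSum≡a)

ehrhartSeries : (ℕ → ℕ) → Series
ehrhartSeries L zero    = 1ℤ
ehrhartSeries L (suc t) = + L (suc t)

EhrhartCounts : ∀ {N} → List (Pt N) → (ℕ → ℕ) → Set
EhrhartCounts pts L = ∀ t → LatticeCount pts (suc t) (L (suc t))

module _ {N : ℕ} {pts : List (Pt N)} {D : ℕ} {h : List ℤ} where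

  private
    -- IsHStar pads L by L′ 0 = 1 in a where-block that cannot be named; unifying IsHStar
    -- with its own unfolding recovers the summand  sign j * (D C j) * L′ L (m ∸ j).
    summandOf : ∀ {F : (ℕ → ℕ) → ℕ → ℕ → ℤ} →
      IsHStar pts D h ≡ Σ (ℕ → ℕ) (λ L → EhrhartCounts pts L × (∀ m → coeff h m ≡ sumUpTo m (F L m))) →
      (ℕ → ℕ) → ℕ → ℕ → ℤ
    summandOf {F} _ = F

    summand : (ℕ → ℕ) → ℕ → ℕ → ℤ
    summand = summandOf refl

    summand-ehrhartSeries : ∀ L m j → summand L m j ≡ binomial D j * ehrhartSeries L (m ∸ j)
    summand-ehrhartSeries L m j =
      cong (binomial D j *_) (trans (sym (ℤP.*-identityˡ _)) (padding (m ∸ j)))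
      where
      padding : ∀ k → summand L k 0 ≡ ehrhartSeries L k
      padding zero    = refl
      padding (suc t) = ℤP.*-identityˡ (+ L (suc t))

    sumUpTo-summand : ∀ L m → sumUpTo m (summand L m) ≡ (binomial D ⋆ ehrhartSeries L) m
    sumUpTo-summand L m =
      trans (sumUpTo-cong m (summand-ehrhartSeries L m)) (sumUpTo-⋆ (binomial D) (ehrhartSeries L) m)

  isHStar⇔ : IsHStar pts D h ⇔ Σ (ℕ → ℕ) (λ L → EhrhartCounts pts L × coeff h ≗ binomial D ⋆ ehrhartSeries L)
  isHStar⇔ = mk⇔
    (λ (L , counts , coeffs) → L , counts , λ m → trans (coeffs m) (sumUpTo-summand L m))
    (λ (L , counts , coeffs) → L , counts , λ m → trans (coeffs m) (sym (sumUpTo-summand L m)))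

module Dilates {N : ℕ} (pts : List (Pt N)) (L : ℕ → ℕ) (counts : EhrhartCounts pts L) where

  dilate : ℕ → List (Pt N)
  dilate zero    = origin ∷ []
  dilate (suc t) = proj₁ (counts t)

  dilate-unique : ∀ t → Unique (dilate t)
  dilate-unique zero    = [] AllPairs.∷ AllPairs.[]
  dilate-unique (suc t) = proj₁ (proj₂ (proj₂ (counts t)))

  length-dilate : ∀ t → + length (dilate t) ≡ ehrhartSeries L t
  length-dilate zero    = refl
  length-dilate (suc t) = cong +_ (proj₁ (proj₂ (counts t)))

  ∈-dilate⁻ : ∀ t {x} → x ∈ dilate t → Conic pts (toℚ (+ t)) (toℚᵛ x)
  ∈-dilate⁻ zero    (here refl) =
    conic-cong refl (λ α → sym (cong toℚ (VecP.lookup∘tabulate (const 0ℤ) α))) (conic-zero pts)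
  ∈-dilate⁻ (suc t) {x} x∈      = weighted⇒conic pts (proj₁ (proj₂ (proj₂ (proj₂ (counts t))) x) x∈)

  ∈-dilate⁺ : ∀ t x → Conic pts (toℚ (+ t)) (toℚᵛ x) → x ∈ dilate t
  ∈-dilate⁺ zero    x c = here (toℚᵛ-injective λ α →
    trans (conic-weight-zero c α) (cong toℚ (sym (VecP.lookup∘tabulate (const 0ℤ) α))))
  ∈-dilate⁺ (suc t) x c = proj₂ (proj₂ (proj₂ (proj₂ (counts t))) x) (conic⇒weighted c)

  dilate-disjoint : CoordSumOne pts → ∀ {a a′ x} → x ∈ dilate a → x ∈ dilate a′ → a ≡ a′
  dilate-disjoint pts≡1 {a} {a′} {x} x∈a x∈a′ = ℤP.+-injective (toℚ-injective (trans
    (conic-coordSum {x = x} pts≡1 (∈-dilate⁻ a x∈a)) (sym (conic-coordSum {x = x} pts≡1 (∈-dilate⁻ a′ x∈a′)))))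

relabel : ∀ {M N} → Fin M ↔ Fin N → Pt M → Pt N
relabel π = reindex (just ∘ Inverse.from π)

relabel-cancel : ∀ {M N} (π : Fin M ↔ Fin N) p → relabel (↔-sym π) (relabel π p) ≡ p
relabel-cancel π =
  reindex-cancel (just ∘ Inverse.to π) (just ∘ Inverse.from π) (cong just ∘ Inverse.strictlyInverseʳ π)

relabel-unit : ∀ {M N} (π : Fin M ↔ Fin N) a → relabel π (unit a) ≡ unit (Inverse.to π a)
relabel-unit π a = reindex-unit (cong just (Inverse.strictlyInverseʳ π a))
  (λ β πβ≡a → trans (sym (Inverse.strictlyInverseˡ π β)) (cong (Inverse.to π) (just-injective πβ≡a)))

conic-relabel : ∀ {M N} (π : Fin M ↔ Fin N) {ps s} x →
  Conic ps s (toℚᵛ x) → Conic (List.map (relabel π) ps) s (toℚᵛ (relabel π x))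
conic-relabel π x c =
  conic-cong refl (sym ∘ toℚᵛ-reindex (just ∘ Inverse.from π) x) (conic-reindex (just ∘ Inverse.from π) c)

latticeCount-relabel : ∀ {M N} (π : Fin M ↔ Fin N) {ps qs t c} →
  List.map (relabel π) ps ⊆ qs → qs ⊆ List.map (relabel π) ps →
  LatticeCount qs t c → LatticeCount ps t c
latticeCount-relabel π {ps} {qs} {t} πps⊆qs qs⊆πps (ys , length≡c , ys-unique , ∈ys⇔) =
  List.map π⁻¹ ys , trans (ListP.length-map π⁻¹ ys) length≡c ,
  Unique.map⁺ relabel-injective ys-unique , λ x → sound x , complete x
  where
  π⁻¹ = relabel (↔-sym π)
  relabel-injective : ∀ {y y′} → π⁻¹ y ≡ π⁻¹ y′ → y ≡ y′
  relabel-injective {y} {y′} eq = begin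
    y                      ≡⟨ relabel-cancel (↔-sym π) y ⟨
    relabel π (π⁻¹ y)      ≡⟨ cong (relabel π) eq ⟩
    relabel π (π⁻¹ y′)     ≡⟨ relabel-cancel (↔-sym π) y′ ⟩
    y′                     ∎
    where open ≡-Reasoning
  sound : ∀ x → x ∈ List.map π⁻¹ ys → InDilate ps t x
  sound x x∈ with ∈-map⁻ π⁻¹ x∈
  ... | y , y∈ , refl = conic⇒weighted (subst (λ ps′ → Conic ps′ _ _) (map-cancel (relabel-cancel π) ps)
          (conic-relabel (↔-sym π) y (conic-⊆ qs⊆πps (weighted⇒conic qs (proj₁ (∈ys⇔ y) y∈)))))
  complete : ∀ x → InDilate ps t x → x ∈ List.map π⁻¹ ys
  complete x d = subst (_∈ List.map π⁻¹ ys) (relabel-cancel π x)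
    (∈-map⁺ π⁻¹ (proj₂ (∈ys⇔ (relabel π x))
      (conic⇒weighted (conic-⊆ πps⊆qs (conic-relabel π x (weighted⇒conic ps d))))))

ehrhartCounts-relabel : ∀ {M N} (π : Fin M ↔ Fin N) {ps qs L} →
  List.map (relabel π) ps ⊆ qs → qs ⊆ List.map (relabel π) ps →
  EhrhartCounts qs L → EhrhartCounts ps L
ehrhartCounts-relabel π {L = L} πps⊆qs qs⊆πps counts t =
  latticeCount-relabel π {t = suc t} {L (suc t)} πps⊆qs qs⊆πps (counts t)

-- Free joins

isInj₁≡just : ∀ {A B : Set} {s : A ⊎ B} {a} → isInj₁ s ≡ just a → s ≡ inj₁ a
isInj₁≡just {s = inj₁ _} refl = refl

isInj₂≡just : ∀ {A B : Set} {s : A ⊎ B} {b} → isInj₂ s ≡ just b → s ≡ inj₂ b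
isInj₂≡just {s = inj₂ _} refl = refl

module FreeJoin {m n D : ℕ} (split : Fin D ↔ (Fin m ⊎ Fin n)) where

  open Inverse split using (to; from; strictlyInverseˡ; strictlyInverseʳ)

  inject₁ : Pt m → Pt D
  inject₁ = reindex (isInj₁ ∘ to)

  inject₂ : Pt n → Pt D
  inject₂ = reindex (isInj₂ ∘ to)

  project₁ : Pt D → Pt m
  project₁ = reindex (just ∘ from ∘ inj₁)

  project₂ : Pt D → Pt n
  project₂ = reindex (just ∘ from ∘ inj₂)

  pair : Pt m → Pt n → Pt D
  pair y z = tabulate ([ lookup y , lookup z ] ∘ to)

  freeJoin : List (Pt m) → List (Pt n) → List (Pt D)
  freeJoin A B = List.map inject₁ A ++ List.map inject₂ B

  inject₁-unit : ∀ γ → inject₁ (unit γ) ≡ unit (from (inj₁ γ))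
  inject₁-unit γ = reindex-unit (cong isInj₁ (strictlyInverseˡ (inj₁ γ)))
    (λ β eq → trans (sym (strictlyInverseʳ β)) (cong from (isInj₁≡just eq)))

  inject₂-unit : ∀ δ → inject₂ (unit δ) ≡ unit (from (inj₂ δ))
  inject₂-unit δ = reindex-unit (cong isInj₂ (strictlyInverseˡ (inj₂ δ)))
    (λ β eq → trans (sym (strictlyInverseʳ β)) (cong from (isInj₂≡just eq)))

  project₁-inject₁ : ∀ y → project₁ (inject₁ y) ≡ y
  project₁-inject₁ = reindex-cancel (just ∘ from ∘ inj₁) (isInj₁ ∘ to) (cong isInj₁ ∘ strictlyInverseˡ ∘ inj₁)

  project₂-inject₂ : ∀ z → project₂ (inject₂ z) ≡ z
  project₂-inject₂ = reindex-cancel (just ∘ from ∘ inj₂) (isInj₂ ∘ to) (cong isInj₂ ∘ strictlyInverseˡ ∘ inj₂)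

  inject₂-vanishes₁ : ∀ z γ → lookup (inject₂ z) (from (inj₁ γ)) ≡ 0ℤ
  inject₂-vanishes₁ z γ =
    trans (lookup-reindex (isInj₂ ∘ to) z (from (inj₁ γ)))
          (cong (maybe (lookup z) 0ℤ ∘ isInj₂) (strictlyInverseˡ (inj₁ γ)))

  inject₁-vanishes₂ : ∀ y δ → lookup (inject₁ y) (from (inj₂ δ)) ≡ 0ℤ
  inject₁-vanishes₂ y δ =
    trans (lookup-reindex (isInj₁ ∘ to) y (from (inj₂ δ)))
          (cong (maybe (lookup y) 0ℤ ∘ isInj₁) (strictlyInverseˡ (inj₂ δ)))

  lookup-pair : ∀ y z β → lookup (pair y z) β ≡ [ lookup y , lookup z ] (to β)
  lookup-pair y z = VecP.lookup∘tabulate ([ lookup y , lookup z ] ∘ to)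

  project₁-pair : ∀ y z → project₁ (pair y z) ≡ y
  project₁-pair y z = trans (VecP.tabulate-cong λ γ →
    trans (lookup-pair y z (from (inj₁ γ))) (cong [ lookup y , lookup z ] (strictlyInverseˡ (inj₁ γ))))
    (VecP.tabulate∘lookup y)

  project₂-pair : ∀ y z → project₂ (pair y z) ≡ z
  project₂-pair y z = trans (VecP.tabulate-cong λ δ →
    trans (lookup-pair y z (from (inj₂ δ))) (cong [ lookup y , lookup z ] (strictlyInverseˡ (inj₂ δ))))
    (VecP.tabulate∘lookup z)

  pair-project : ∀ x → pair (project₁ x) (project₂ x) ≡ x
  pair-project x =
    trans (VecP.tabulate-cong λ β → lookup-≡ (to β) (strictlyInverseʳ β)) (VecP.tabulate∘lookup x)
    where
    lookup-≡ : ∀ {β} s → from s ≡ β → [ lookup (project₁ x) , lookup (project₂ x) ] s ≡ lookup x β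
    lookup-≡ (inj₁ γ) eq = trans (lookup-reindex (just ∘ from ∘ inj₁) x γ) (cong (lookup x) eq)
    lookup-≡ (inj₂ δ) eq = trans (lookup-reindex (just ∘ from ∘ inj₂) x δ) (cong (lookup x) eq)

  pair-injective : ∀ {y y′ z z′} → pair y z ≡ pair y′ z′ → y ≡ y′ × z ≡ z′
  pair-injective {y} {y′} {z} {z′} eq =
    trans (sym (project₁-pair y z)) (trans (cong project₁ eq) (project₁-pair y′ z′)) ,
    trans (sym (project₂-pair y z)) (trans (cong project₂ eq) (project₂-pair y′ z′))

  conic-pair : ∀ {A B a b y z} → Conic A a (toℚᵛ y) → Conic B b (toℚᵛ z) →
    Conic (freeJoin A B) (a ℚ.+ b) (toℚᵛ (pair y z))
  conic-pair {y = y} {z} cA cB =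
    conic-cong refl (λ β → trans (pieces (to β)) (cong toℚ (sym (lookup-pair y z β))))
      (conic-++⁺ (conic-reindex (isInj₁ ∘ to) cA) (conic-reindex (isInj₂ ∘ to) cB))
    where
    pieces : ∀ s → maybe (toℚᵛ y) 0ℚ (isInj₁ s) ℚ.+ maybe (toℚᵛ z) 0ℚ (isInj₂ s) ≡
                   toℚ ([ lookup y , lookup z ] s)
    pieces (inj₁ γ) = ℚP.+-identityʳ _
    pieces (inj₂ δ) = ℚP.+-identityˡ _

  conic-unpair : ∀ A {B s x} → Conic (freeJoin A B) s (toℚᵛ x) →
    ∃₂ λ s₁ s₂ → s ≡ s₁ ℚ.+ s₂ × Conic A s₁ (toℚᵛ (project₁ x)) × Conic B s₂ (toℚᵛ (project₂ x))
  conic-unpair A {B} {x = x} c with conic-++⁻ (List.map inject₁ A) c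
  ... | s₁ , s₂ , x₁ , x₂ , s≡ , x≗ , c₁ , c₂ =
    s₁ , s₂ , s≡ ,
    subst (λ ps → Conic ps s₁ _) (map-cancel project₁-inject₁ A)
      (conic-cong refl restrict₁ (conic-reindex (just ∘ from ∘ inj₁) c₁)) ,
    subst (λ ps → Conic ps s₂ _) (map-cancel project₂-inject₂ B)
      (conic-cong refl restrict₂ (conic-reindex (just ∘ from ∘ inj₂) c₂))
    where
    open ≡-Reasoning
    vanish₁ : ∀ γ → x₂ (from (inj₁ γ)) ≡ 0ℚ
    vanish₁ γ = conic-vanish (from (inj₁ γ)) on-inject₂ c₂
      where
      on-inject₂ : ∀ {p} → p ∈ List.map inject₂ B → lookup p (from (inj₁ γ)) ≡ 0ℤ
      on-inject₂ p∈ = let z , _ , p≡ = ∈-map⁻ inject₂ p∈ in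
        trans (cong (λ p → lookup p (from (inj₁ γ))) p≡) (inject₂-vanishes₁ z γ)
    vanish₂ : ∀ δ → x₁ (from (inj₂ δ)) ≡ 0ℚ
    vanish₂ δ = conic-vanish (from (inj₂ δ)) on-inject₁ c₁
      where
      on-inject₁ : ∀ {p} → p ∈ List.map inject₁ A → lookup p (from (inj₂ δ)) ≡ 0ℤ
      on-inject₁ p∈ = let y , _ , p≡ = ∈-map⁻ inject₁ p∈ in
        trans (cong (λ p → lookup p (from (inj₂ δ))) p≡) (inject₁-vanishes₂ y δ)
    restrict₁ : ∀ γ → x₁ (from (inj₁ γ)) ≡ toℚᵛ (project₁ x) γ
    restrict₁ γ = begin
      x₁ (from (inj₁ γ))                        ≡⟨ ℚP.+-identityʳ _ ⟨
      x₁ (from (inj₁ γ)) ℚ.+ 0ℚ                 ≡⟨ cong (x₁ (from (inj₁ γ)) ℚ.+_) (vanish₁ γ) ⟨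
      x₁ (from (inj₁ γ)) ℚ.+ x₂ (from (inj₁ γ)) ≡⟨ x≗ (from (inj₁ γ)) ⟨
      toℚᵛ x (from (inj₁ γ))                    ≡⟨ toℚᵛ-reindex (just ∘ from ∘ inj₁) x γ ⟨
      toℚᵛ (project₁ x) γ                       ∎
    restrict₂ : ∀ δ → x₂ (from (inj₂ δ)) ≡ toℚᵛ (project₂ x) δ
    restrict₂ δ = begin
      x₂ (from (inj₂ δ))                        ≡⟨ ℚP.+-identityˡ _ ⟨
      0ℚ ℚ.+ x₂ (from (inj₂ δ))                 ≡⟨ cong (ℚ._+ x₂ (from (inj₂ δ))) (vanish₂ δ) ⟨
      x₁ (from (inj₂ δ)) ℚ.+ x₂ (from (inj₂ δ)) ≡⟨ x≗ (from (inj₂ δ)) ⟨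
      toℚᵛ x (from (inj₂ δ))                    ≡⟨ toℚᵛ-reindex (just ∘ from ∘ inj₂) x δ ⟨
      toℚᵛ (project₂ x) δ                       ∎

  module _ {A : List (Pt m)} {B : List (Pt n)} (A≡1 : CoordSumOne A) (B≡1 : CoordSumOne B) where

    conic-unpair-ℕ : ∀ {t x} → Conic (freeJoin A B) (toℚ (+ t)) (toℚᵛ x) →
      ∃₂ λ a b → a ℕ.+ b ≡ t × Conic A (toℚ (+ a)) (toℚᵛ (project₁ x)) × Conic B (toℚ (+ b)) (toℚᵛ (project₂ x))
    -- Destructured with let: a with-clause here makes Agda normalise toℚ (+ t), which is very
    -- expensive for a variable t.
    conic-unpair-ℕ {t} {x} c =
      let s₁ , s₂ , t≡s₁+s₂ , c₁ , c₂ = conic-unpair A {x = x} c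
          a , s₁≡a = conic-weight-ℕ {x = project₁ x} A≡1 c₁
          b , s₂≡b = conic-weight-ℕ {x = project₂ x} B≡1 c₂
          t≡a+b = trans t≡s₁+s₂ (trans (cong₂ ℚ._+_ s₁≡a s₂≡b) (sym (toℚ-+ (+ a) (+ b))))
      in a , b , sym (ℤP.+-injective (toℚ-injective t≡a+b)) ,
         conic-cong s₁≡a (λ _ → refl) c₁ , conic-cong s₂≡b (λ _ → refl) c₂

    ehrhartCounts-freeJoin : ∀ {L₁ L₂} → EhrhartCounts A L₁ → EhrhartCounts B L₂ →
      Σ (ℕ → ℕ) λ L → EhrhartCounts (freeJoin A B) L × ehrhartSeries L ≗ ehrhartSeries L₁ ⋆ ehrhartSeries L₂
    ehrhartCounts-freeJoin {L₁} {L₂} countsA countsB = length ∘ Z , counts , series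
      where
      module X = Dilates A L₁ countsA
      module Y = Dilates B L₂ countsB
      Z : ℕ → List (Pt D)
      Z = convolveWith pair X.dilate Y.dilate
      sound : ∀ t {x} → x ∈ Z t → InDilate (freeJoin A B) t x
      sound t {x} x∈ =
        let a , b , a+b≡t , y , z , y∈ , z∈ , x≡yz = ∈-convolveWith⁻ pair X.dilate Y.dilate t x∈
        in conic⇒weighted (conic-cong (trans (sym (toℚ-+ (+ a) (+ b))) (cong (toℚ ∘ +_) a+b≡t))
                                      (λ α → cong (λ w → toℚᵛ w α) (sym x≡yz))
                                      (conic-pair {y = y} {z} (X.∈-dilate⁻ a y∈) (Y.∈-dilate⁻ b z∈)))
      complete : ∀ t {x} → InDilate (freeJoin A B) t x → x ∈ Z t
      complete t {x} d =
        let a , b , a+b≡t , c₁ , c₂ = conic-unpair-ℕ {t} {x} (weighted⇒conic (freeJoin A B) d)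
        in subst₂ (λ w s → w ∈ Z s) (pair-project x) a+b≡t
             (∈-convolveWith⁺ pair X.dilate Y.dilate a b
               (X.∈-dilate⁺ a (project₁ x) c₁) (Y.∈-dilate⁺ b (project₂ x) c₂))
      counts : EhrhartCounts (freeJoin A B) (length ∘ Z)
      counts t = Z (suc t) , refl ,
        convolveWith-unique pair X.dilate Y.dilate pair-injective X.dilate-unique Y.dilate-unique
          (X.dilate-disjoint A≡1) (suc t) ,
        λ x → sound (suc t) , complete (suc t)
      series : ehrhartSeries (length ∘ Z) ≗ ehrhartSeries L₁ ⋆ ehrhartSeries L₂
      series zero    = refl
      series (suc t) = trans (length-convolveWith pair X.dilate Y.dilate (suc t))
                             (⋆-cong X.length-dilate Y.length-dilate (suc t))

-- Cosmological polytopes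

cosmoTriple : ∀ {N} → Fin N → Fin N → Fin N → List (Pt N)
cosmoTriple a b c =
  (unit a +ᵥ unit b) -ᵥ unit c ∷ (unit a -ᵥ unit b) +ᵥ unit c ∷ (unit b -ᵥ unit a) +ᵥ unit c ∷ []

cosmoTriple-coordSum : ∀ {N} (a b c : Fin N) → CoordSumOne (cosmoTriple a b c)
cosmoTriple-coordSum a b c (here refl)
  rewrite coordSum-[-ᵥ] (unit a +ᵥ unit b) (unit c) | coordSum-+ᵥ (unit a) (unit b)
        | coordSum-unit a | coordSum-unit b | coordSum-unit c = refl
cosmoTriple-coordSum a b c (there (here refl))
  rewrite coordSum-+ᵥ (unit a -ᵥ unit b) (unit c) | coordSum-[-ᵥ] (unit a) (unit b)
        | coordSum-unit a | coordSum-unit b | coordSum-unit c = refl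
cosmoTriple-coordSum a b c (there (there (here refl)))
  rewrite coordSum-+ᵥ (unit b -ᵥ unit a) (unit c) | coordSum-[-ᵥ] (unit b) (unit a)
        | coordSum-unit a | coordSum-unit b | coordSum-unit c = refl

cosmoTriple-swap : ∀ {N} (a b c : Fin N) → cosmoTriple b a c ⊆ cosmoTriple a b c
cosmoTriple-swap a b c (here refl) = here (cong (_-ᵥ unit c) (VecP.zipWith-comm ℤP.+-comm (unit b) (unit a)))
cosmoTriple-swap a b c (there (here refl))         = there (there (here refl))
cosmoTriple-swap a b c (there (there (here refl))) = there (here refl)

map-reindex-cosmoTriple : ∀ {M N} (ρ : Fin N → Maybe (Fin M)) {a b c a′ b′ c′} →
  reindex ρ (unit a) ≡ unit a′ → reindex ρ (unit b) ≡ unit b′ → reindex ρ (unit c) ≡ unit c′ →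
  List.map (reindex ρ) (cosmoTriple a b c) ≡ cosmoTriple a′ b′ c′
map-reindex-cosmoTriple ρ {a} {b} {c} ρa ρb ρc =
  cong₂ _∷_ (trans (reindex-[-ᵥ] (unit a +ᵥ unit b) (unit c))
                   (cong₂ _-ᵥ_ (trans (reindex-+ᵥ (unit a) (unit b)) (cong₂ _+ᵥ_ ρa ρb)) ρc))
 (cong₂ _∷_ (trans (reindex-+ᵥ (unit a -ᵥ unit b) (unit c))
                   (cong₂ _+ᵥ_ (trans (reindex-[-ᵥ] (unit a) (unit b)) (cong₂ _-ᵥ_ ρa ρb)) ρc))
 (cong₂ _∷_ (trans (reindex-+ᵥ (unit b -ᵥ unit a) (unit c))
                   (cong₂ _+ᵥ_ (trans (reindex-[-ᵥ] (unit b) (unit a)) (cong₂ _-ᵥ_ ρb ρa)) ρc))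
            refl))
  where
  reindex-+ᵥ : ∀ u v → reindex ρ (u +ᵥ v) ≡ reindex ρ u +ᵥ reindex ρ v
  reindex-+ᵥ = reindex-zipWith ρ _+_ refl
  reindex-[-ᵥ] : ∀ u v → reindex ρ (u -ᵥ v) ≡ reindex ρ u -ᵥ reindex ρ v
  reindex-[-ᵥ] = reindex-zipWith ρ _-_ refl

vertexCoord : (G : Graph) → Fin (nV G) → Fin (dimG G)
vertexCoord G v = v ↑ˡ nE G

edgeCoord : (G : Graph) → Fin (nE G) → Fin (dimG G)
edgeCoord G f = nV G ↑ʳ f

edgeGens : (G : Graph) → Fin (nE G) → List (Pt (dimG G))
edgeGens G f = cosmoTriple (vertexCoord G (proj₁ (ends G f))) (vertexCoord G (proj₂ (ends G f))) (edgeCoord G f)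

edgeGens⊆cosmoGens : ∀ G f → edgeGens G f ⊆ cosmoGens G
edgeGens⊆cosmoGens G f p∈ = ∈-concatMap⁺ (edgeGens G) (lose (∈-allFin f) p∈)

cosmoGens⁻ : ∀ G {p} → p ∈ cosmoGens G → ∃ λ f → p ∈ edgeGens G f
cosmoGens⁻ G p∈ = satisfied (∈-concatMap⁻ (edgeGens G) {allFin (nE G)} p∈)

cosmoGens-coordSum : ∀ G → CoordSumOne (cosmoGens G)
cosmoGens-coordSum G p∈ = let f , p∈f = cosmoGens⁻ G p∈ in cosmoTriple-coordSum _ _ _ p∈f

edgeGens-Joins : ∀ G {e u v} → Joins G e u v →
  edgeGens G e ⊆ cosmoTriple (vertexCoord G u) (vertexCoord G v) (edgeCoord G e) ×
  cosmoTriple (vertexCoord G u) (vertexCoord G v) (edgeCoord G e) ⊆ edgeGens G e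
edgeGens-Joins G {e} (inj₁ ends≡uv) rewrite ends≡uv = (λ p∈ → p∈) , (λ p∈ → p∈)
edgeGens-Joins G {e} (inj₂ ends≡vu) rewrite ends≡vu = cosmoTriple-swap _ _ _ , cosmoTriple-swap _ _ _

map-reindex-edgeGens : ∀ G K (ρ : Fin (dimG K) → Maybe (Fin (dimG G)))
  (κV : Fin (nV G) → Fin (nV K)) (κE : Fin (nE G) → Fin (nE K)) →
  (∀ v → reindex ρ (unit (vertexCoord G v)) ≡ unit (vertexCoord K (κV v))) →
  (∀ f → reindex ρ (unit (edgeCoord G f)) ≡ unit (edgeCoord K (κE f))) →
  ∀ f → List.map (reindex ρ) (edgeGens G f) ≡
        cosmoTriple (vertexCoord K (κV (proj₁ (ends G f)))) (vertexCoord K (κV (proj₂ (ends G f))))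
                    (edgeCoord K (κE f))
map-reindex-edgeGens G K ρ κV κE ρV ρE f =
  map-reindex-cosmoTriple ρ (ρV (proj₁ (ends G f))) (ρV (proj₂ (ends G f))) (ρE f)

dimG-⊕ : ∀ G H → dimG (G ⊕ H) ≡ dimG G ℕ.+ dimG H
dimG-⊕ G H = interchange (nV G) (nV H) (nE G) (nE H)
  where
  interchange : ∀ a b c d → (a ℕ.+ b) ℕ.+ (c ℕ.+ d) ≡ (a ℕ.+ c) ℕ.+ (b ℕ.+ d)
  interchange = ℕ-solve-∀

⊎-interchange : ∀ {A B C D : Set} → ((A ⊎ B) ⊎ (C ⊎ D)) ↔ ((A ⊎ C) ⊎ (B ⊎ D))
⊎-interchange = mk↔ₛ′ swapMiddle swapMiddle swapMiddle-involutive swapMiddle-involutive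
  where
  swapMiddle : ∀ {A B C D : Set} → (A ⊎ B) ⊎ (C ⊎ D) → (A ⊎ C) ⊎ (B ⊎ D)
  swapMiddle (inj₁ (inj₁ a)) = inj₁ (inj₁ a)
  swapMiddle (inj₁ (inj₂ b)) = inj₂ (inj₁ b)
  swapMiddle (inj₂ (inj₁ c)) = inj₁ (inj₂ c)
  swapMiddle (inj₂ (inj₂ d)) = inj₂ (inj₂ d)
  swapMiddle-involutive : ∀ {A B C D : Set} (s : (A ⊎ B) ⊎ (C ⊎ D)) → swapMiddle (swapMiddle s) ≡ s
  swapMiddle-involutive (inj₁ (inj₁ _)) = refl
  swapMiddle-involutive (inj₁ (inj₂ _)) = refl
  swapMiddle-involutive (inj₂ (inj₁ _)) = refl
  swapMiddle-involutive (inj₂ (inj₂ _)) = refl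

coords-⊕ : ∀ G H → Fin (dimG (G ⊕ H)) ↔ (Fin (dimG G) ⊎ Fin (dimG H))
coords-⊕ G H =
  ↔-trans (+↔⊎ {nV G ℕ.+ nV H})
    (↔-trans (⊎-cong (+↔⊎ {nV G}) (+↔⊎ {nE G}))
      (↔-trans ⊎-interchange (⊎-cong (↔-sym (+↔⊎ {nV G})) (↔-sym (+↔⊎ {nV H})))))

module _ (G H : Graph) where

  open FreeJoin (coords-⊕ G H)
  open Inverse (coords-⊕ G H) using (to)

  ends-⊕ˡ : ∀ f → ends (G ⊕ H) (f ↑ˡ nE H) ≡ (proj₁ (ends G f) ↑ˡ nV H , proj₂ (ends G f) ↑ˡ nV H)
  ends-⊕ˡ f rewrite splitAt-↑ˡ (nE G) f (nE H) = refl

  ends-⊕ʳ : ∀ f → ends (G ⊕ H) (nE G ↑ʳ f) ≡ (nV G ↑ʳ proj₁ (ends H f) , nV G ↑ʳ proj₂ (ends H f))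
  ends-⊕ʳ f rewrite splitAt-↑ʳ (nE G) (nE H) f = refl

  inject₁-vertex : ∀ v → inject₁ (unit (vertexCoord G v)) ≡ unit (vertexCoord (G ⊕ H) (v ↑ˡ nV H))
  inject₁-vertex v rewrite inject₁-unit (vertexCoord G v) | splitAt-↑ˡ (nV G) v (nE G) = refl

  inject₁-edge : ∀ f → inject₁ (unit (edgeCoord G f)) ≡ unit (edgeCoord (G ⊕ H) (f ↑ˡ nE H))
  inject₁-edge f rewrite inject₁-unit (edgeCoord G f) | splitAt-↑ʳ (nV G) (nE G) f = refl

  inject₂-vertex : ∀ v → inject₂ (unit (vertexCoord H v)) ≡ unit (vertexCoord (G ⊕ H) (nV G ↑ʳ v))
  inject₂-vertex v rewrite inject₂-unit (vertexCoord H v) | splitAt-↑ˡ (nV H) v (nE H) = refl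

  inject₂-edge : ∀ f → inject₂ (unit (edgeCoord H f)) ≡ unit (edgeCoord (G ⊕ H) (nE G ↑ʳ f))
  inject₂-edge f rewrite inject₂-unit (edgeCoord H f) | splitAt-↑ʳ (nV H) (nE H) f = refl

  edgeGens-⊕ˡ : ∀ f → edgeGens (G ⊕ H) (f ↑ˡ nE H) ≡ List.map inject₁ (edgeGens G f)
  edgeGens-⊕ˡ f = trans
    (cong (λ e → cosmoTriple (vertexCoord (G ⊕ H) (proj₁ e)) (vertexCoord (G ⊕ H) (proj₂ e))
                             (edgeCoord (G ⊕ H) (f ↑ˡ nE H)))
          (ends-⊕ˡ f))
    (sym (map-reindex-edgeGens G (G ⊕ H) (isInj₁ ∘ to) (_↑ˡ nV H) (_↑ˡ nE H) inject₁-vertex inject₁-edge f))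

  edgeGens-⊕ʳ : ∀ f → edgeGens (G ⊕ H) (nE G ↑ʳ f) ≡ List.map inject₂ (edgeGens H f)
  edgeGens-⊕ʳ f = trans
    (cong (λ e → cosmoTriple (vertexCoord (G ⊕ H) (proj₁ e)) (vertexCoord (G ⊕ H) (proj₂ e))
                             (edgeCoord (G ⊕ H) (nE G ↑ʳ f)))
          (ends-⊕ʳ f))
    (sym (map-reindex-edgeGens H (G ⊕ H) (isInj₂ ∘ to) (nV G ↑ʳ_) (nE G ↑ʳ_) inject₂-vertex inject₂-edge f))

  cosmoGens-⊕ : cosmoGens (G ⊕ H) ≡ freeJoin (cosmoGens G) (cosmoGens H)
  cosmoGens-⊕ = begin
    concatMap (edgeGens (G ⊕ H)) (allFin (nE G ℕ.+ nE H))
      ≡⟨ concatMap-allFin-+ (nE G) (nE H) (edgeGens (G ⊕ H)) ⟩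
    concatMap (edgeGens (G ⊕ H) ∘ (_↑ˡ nE H)) (allFin (nE G)) ++
    concatMap (edgeGens (G ⊕ H) ∘ (nE G ↑ʳ_)) (allFin (nE H))
      ≡⟨ cong₂ _++_ (ListP.concatMap-cong edgeGens-⊕ˡ (allFin (nE G)))
                    (ListP.concatMap-cong edgeGens-⊕ʳ (allFin (nE H))) ⟩
    concatMap (List.map inject₁ ∘ edgeGens G) (allFin (nE G)) ++
    concatMap (List.map inject₂ ∘ edgeGens H) (allFin (nE H))
      ≡⟨ cong₂ _++_ (ListP.map-concatMap inject₁ (edgeGens G) (allFin (nE G)))
                    (ListP.map-concatMap inject₂ (edgeGens H) (allFin (nE H))) ⟨
    freeJoin (cosmoGens G) (cosmoGens H) ∎
    where open ≡-Reasoning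

coords-≅ : ∀ {G H} → G ≅ H → Fin (dimG G) ↔ Fin (dimG H)
coords-≅ {G} {H} iso = ↔-trans (+↔⊎ {nV G}) (↔-trans (⊎-cong (_≅_.φV iso) (_≅_.φE iso)) (↔-sym (+↔⊎ {nV H})))

module _ {G H : Graph} (iso : G ≅ H) where

  open _≅_ iso

  private
    π = coords-≅ iso

  relabel-vertex : ∀ v → relabel π (unit (vertexCoord G v)) ≡ unit (vertexCoord H (Inverse.to φV v))
  relabel-vertex v rewrite relabel-unit π (vertexCoord G v) | splitAt-↑ˡ (nV G) v (nE G) = refl

  relabel-edge : ∀ f → relabel π (unit (edgeCoord G f)) ≡ unit (edgeCoord H (Inverse.to φE f))
  relabel-edge f rewrite relabel-unit π (edgeCoord G f) | splitAt-↑ʳ (nV G) (nE G) f = refl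

  map-relabel-edgeGens : ∀ f → List.map (relabel π) (edgeGens G f) ≡
    cosmoTriple (vertexCoord H (Inverse.to φV (proj₁ (ends G f))))
                (vertexCoord H (Inverse.to φV (proj₂ (ends G f))))
                (edgeCoord H (Inverse.to φE f))
  map-relabel-edgeGens =
    map-reindex-edgeGens G H (just ∘ Inverse.from π) (Inverse.to φV) (Inverse.to φE) relabel-vertex relabel-edge

  relabel-cosmoGens⊆ : List.map (relabel π) (cosmoGens G) ⊆ cosmoGens H
  relabel-cosmoGens⊆ p∈ with ∈-map⁻ (relabel π) p∈
  ... | q , q∈ , refl with cosmoGens⁻ G q∈
  ...   | f , q∈f = edgeGens⊆cosmoGens H (Inverse.to φE f)
          (proj₂ (edgeGens-Joins H (preserves f))
            (subst (relabel π q ∈_) (map-relabel-edgeGens f) (∈-map⁺ (relabel π) q∈f)))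

  cosmoGens⊆relabel : cosmoGens H ⊆ List.map (relabel π) (cosmoGens G)
  cosmoGens⊆relabel {p} p∈ with cosmoGens⁻ H p∈
  ... | e , p∈e = Subset.map⁺ (relabel π) (edgeGens⊆cosmoGens G f)
          (subst (p ∈_) (sym (map-relabel-edgeGens f))
            (proj₁ (edgeGens-Joins H (preserves f))
              (subst (λ e → p ∈ edgeGens H e) (sym (Inverse.strictlyInverseˡ φE e)) p∈e)))
    where
    f = Inverse.from φE e

isHStarCosmo⇔ : ∀ G h →
  IsHStarCosmo G h ⇔
  Σ (ℕ → ℕ) (λ L → EhrhartCounts (cosmoGens G) L × coeff h ≗ binomial (dimG G) ⋆ ehrhartSeries L)
isHStarCosmo⇔ G h = isHStar⇔ {pts = cosmoGens G} {D = dimG G} {h = h}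

isHStarCosmo-⊕ : ∀ G H {h k} → IsHStarCosmo G h → IsHStarCosmo H k → IsHStarCosmo (G ⊕ H) (h *P k)
isHStarCosmo-⊕ G H {h} {k} hG hH =
  let LG , countsG , coeffG = Equivalence.to (isHStarCosmo⇔ G h) hG
      LH , countsH , coeffH = Equivalence.to (isHStarCosmo⇔ H k) hH
      L , counts , series = FreeJoin.ehrhartCounts-freeJoin (coords-⊕ G H)
                              (cosmoGens-coordSum G) (cosmoGens-coordSum H) countsG countsH
  in Equivalence.from (isHStarCosmo⇔ (G ⊕ H) (h *P k))
       (L , subst (λ ps → EhrhartCounts ps L) (sym (cosmoGens-⊕ G H)) counts ,
        subst (λ D → coeff (h *P k) ≗ binomial D ⋆ ehrhartSeries L) (sym (dimG-⊕ G H))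
          (coeff-*P-binomial {h} {k} (dimG G) (dimG H) {ehrhartSeries LG} {ehrhartSeries LH}
             coeffG coeffH series))

isHStarCosmo-≅ : ∀ {G H h} → G ≅ H → IsHStarCosmo H h → IsHStarCosmo G h
isHStarCosmo-≅ {G} {H} {h} iso hH =
  let L , counts , coeffs = Equivalence.to (isHStarCosmo⇔ H h) hH
  in Equivalence.from (isHStarCosmo⇔ G h)
       (L , ehrhartCounts-relabel (coords-≅ iso) {L = L} (relabel-cosmoGens⊆ iso) (cosmoGens⊆relabel iso)
                                  counts ,
        subst (λ D → coeff h ≗ binomial D ⋆ ehrhartSeries L) (sym (↔⇒≡ (coords-≅ iso))) coeffs)

isHStarCosmo-empty : IsHStarCosmo emptyGraph (1ℤ ∷ [])
isHStarCosmo-empty = Equivalence.from (isHStarCosmo⇔ emptyGraph (1ℤ ∷ [])) (const 0 , noLatticePoints , coeffs)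
  where
  noLatticePoints : EhrhartCounts (cosmoGens emptyGraph) (const 0)
  noLatticePoints t = [] , refl , AllPairs.[] , λ x → (λ ()) , λ d → ⊥-elim (no-weight (weighted⇒conic [] d))
    where
    no-weight : ∀ {y} → ¬ Conic [] (toℚ (+ suc t)) y
    no-weight (nil t≡0 _) with ℤP.+-injective (toℚ-injective {+ suc t} {0ℤ} t≡0)
    ... | ()
  coeffs : coeff (1ℤ ∷ []) ≗ binomial 0 ⋆ ehrhartSeries (const 0)
  coeffs m = sym (trans (⋆-cong binomial-zero (λ _ → refl) m)
                        (trans (⋆-identityˡ (ehrhartSeries (const 0)) m) (constant m)))
    where
    constant : ehrhartSeries (const 0) ≗ coeff (1ℤ ∷ [])
    constant zero    = refl
    constant (suc _) = refl

isHStarCosmo-⨆ : ∀ {Gs hs} → Pointwise IsHStarCosmo Gs hs → IsHStarCosmo (⨆ Gs) (polyProd hs)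
isHStarCosmo-⨆ []                              = isHStarCosmo-empty
isHStarCosmo-⨆ {G ∷ Gs} {h ∷ hs} (hG ∷ hGs) = isHStarCosmo-⊕ G (⨆ Gs) {h} {polyProd hs} hG (isHStarCosmo-⨆ hGs)

proposition3p1 : (G : Graph) → NoIsolated G →
    (Gs : List Graph) → All Connected Gs → G ≅ ⨆ Gs →
    (hs : List (List ℤ)) → Pointwise IsHStarCosmo Gs hs →
    IsHStarCosmo G (polyProd hs)
proposition3p1 G _ Gs _ G≅⨆Gs hs hGs = isHStarCosmo-≅ {h = polyProd hs} G≅⨆Gs (isHStarCosmo-⨆ hGs)
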